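{- Let $n\ge2$. For every $J\subseteq\{2,\dots,n-1\}$: $$\psi(Y_J)=\sum_{F\in\mathcal F_n,\ F\subseteq J\triangle(J+1)}2^{\#F}P_F,\qquad \psi(Y_{\{1\}\cup J})=\psi(Y_{\{1'\}\cup J})=\sum_{\{1\}\cup F\in\mathcal F_n,\ F\subseteq J\triangle(J+1)}2^{\#F}P_{\{1\}\cup F},$$ $$\psi(Y_{\{1',1\}\cup J})=\sum_{F\in\mathcal F_n,\ F\subseteq J\triangle(\{2\}\cup(J+1))}2^{\#F}P_F,$$ and also $$\psi(X_J)=2^{\#J}\!\!\sum_{F\in\mathcal F_n,\ F\subseteq J\cup(J+1)}\!\!P_F,\quad \psi(X_{\{1\}\cup J})=\psi(X_{\{1'\}\cup J})=2^{\#J}\!\!\sum_{F\in\mathcal F_n,\ F\subseteq J\cup(J+1)\cup\{1\}}\!\!P_F,$$ $$\psi(X_{\{1',1\}\cup J})=2^{\#J+1}\sum_{F\in\mathcal F_n,\ F\subseteq J\cup(J+1)\cup\{1,2\}}P_F.$$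
   Context: Signed permutations: bijections $w$ of $\{\pm1,\dots,\pm n\}$ with $w(-i)=-w(i)$, written $w_1\cdots w_n$, negative entries $-k$ written $\bar k$, ordered $\cdots<\bar2<\bar1<1<2<\cdots$. $\mathcal D_n$ is the group of signed permutations with an even number of negative entries. For $w\in\mathcal D_n$, $\mathrm{Des}(w)\subseteq\{1',1,2,\dots,n-1\}$: $w$ has a descent at $i\in\{1,\dots,n-1\}$ iff $w_i>w_{i+1}$, and at $1'$ iff $-w_1>w_2$. For $J\subseteq\{1',1,\dots,n-1\}$, $Y_J=\sum_{w\in\mathcal D_n,\mathrm{Des}(w)=J}w$ and $X_J=\sum_{I\subseteq J}Y_I$ (elements of Solomon's descent algebra $\Sigma(D_n)$). $\psi:\mathbb Q\mathcal D_n\to\mathbb Q\mathcal S_n$ is the linear map forgetting signs, $w\mapsto|w_1|\cdots|w_n|$. $J+1=\{j+1:j\in J\}$, $\triangle$ is symmetric difference. For $u\in\mathcal S_n$, $\mathrm{Peak}(u)=\{i\in\{1,\dots,n-1\}:u_{i-1}<u_i>u_{i+1}\}$ with $u_0=0$; $\mathcal F_n$ is the set of subsets of $\{1,\dots,n-1\}$ with no two consecutive integers; $P_F=\sum_{\mathrm{Peak}(u)=F}u$. -}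

module Defs where

open import Data.Bool using (Bool; true; false; _∧_; _∨_; not; _xor_; if_then_else_)
open import Data.Nat as ℕ using (ℕ; zero; suc; _^_; _<ᵇ_)
open import Data.Integer as ℤ using (ℤ; +_; -_; ∣_∣; _≤ᵇ_)
open import Data.Fin using (Fin; zero; suc; inject₁)
open import Data.Vec as Vec using (Vec; []; _∷_; lookup; tabulate; zipWith; init; count; toList; allFin)
open import Data.List as List using (List; []; _∷_; concatMap; filterᵇ; map; replicate; concat)
open import Data.Product using (_×_; _,_)
open import Data.Fin.Subset using (Subset; ⁅_⁆; _∪_)

-- Elements of the group algebras QS_n and QD_n with nonnegative integer
-- coefficients are represented as lists of group elements (a formal sum,
-- repeated elements add up); equality of such elements is multiset
-- equality, i.e. the permutation relation _↭_ on lists.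

infixr 5 _·_
_·_ : {A : Set} → ℕ → List A → List A
c · xs = concat (replicate c xs)

Sn : (n : ℕ) → List (Vec ℕ n)
Sn zero    = [] ∷ []
Sn (suc n) = concatMap (λ p → map (λ i → Vec.insertAt p i (suc n)) (toList (allFin (suc n)))) (Sn n)

signings : {n : ℕ} → Vec ℕ n → List (Vec ℤ n)
signings []       = [] ∷ []
signings (x ∷ xs) = concatMap (λ ws → (+ x ∷ ws) ∷ (- (+ x) ∷ ws) ∷ []) (signings xs)

Bn : (n : ℕ) → List (Vec ℤ n)
Bn n = concatMap signings (Sn n)

infix 4 _<ℤ_
_<ℤ_ : ℤ → ℤ → Bool
a <ℤ b = not (b ≤ᵇ a)

isNeg : ℤ → Bool
isNeg z = z <ℤ + 0

negCount : {n : ℕ} → Vec ℤ n → ℕ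
negCount []       = 0
negCount (z ∷ zs) = if isNeg z then suc (negCount zs) else negCount zs

even : ℕ → Bool
even zero          = true
even (suc zero)    = false
even (suc (suc m)) = even m

Dn : (n : ℕ) → List (Vec ℤ n)
Dn n = filterᵇ (λ w → even (negCount w)) (Bn n)

-- For n = k + 2, a subset of {1,…,n-1} is a  Subset (suc k),
-- where index i : Fin (suc k) stands for the integer i+1.
-- A subset of {1',1,…,n-1} (a type-D descent set) is a pair
-- (b , S) with b = true iff 1' belongs to it.

DSet : ℕ → Set
DSet k = Bool × Subset (suc k)

eqBs : {m : ℕ} → Vec Bool m → Vec Bool m → Bool
eqBs []       []       = true
eqBs (x ∷ xs) (y ∷ ys) = not (x xor y) ∧ eqBs xs ys

subᵇ : {m : ℕ} → Vec Bool m → Vec Bool m → Bool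
subᵇ []       []       = true
subᵇ (x ∷ xs) (y ∷ ys) = (not x ∨ y) ∧ subᵇ xs ys

eqD : {k : ℕ} → DSet k → DSet k → Bool
eqD (a , S) (b , T) = not (a xor b) ∧ eqBs S T

subD : {k : ℕ} → DSet k → DSet k → Bool
subD (a , S) (b , T) = (not a ∨ b) ∧ subᵇ S T

allSubsets : (m : ℕ) → List (Vec Bool m)
allSubsets zero    = [] ∷ []
allSubsets (suc m) = concatMap (λ S → (false ∷ S) ∷ (true ∷ S) ∷ []) (allSubsets m)

allDSets : (k : ℕ) → List (DSet k)
allDSets k = concatMap (λ S → (false , S) ∷ (true , S) ∷ []) (allSubsets (suc k))

card : {m : ℕ} → Vec Bool m → ℕ
card []           = 0
card (true ∷ xs)  = suc (card xs)
card (false ∷ xs) = card xs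

-- S + 1 = {s+1 : s ∈ S}, intersected with {1,…,n-1}
shift : {k : ℕ} → Subset (suc k) → Subset (suc k)
shift S = false ∷ init S

infixl 7 _△_
_△_ : {m : ℕ} → Vec Bool m → Vec Bool m → Vec Bool m
_△_ = zipWith _xor_

-- the elements 1 and 2 of {1,…,n-1} (for n = 2, {2} ∩ {1} = ∅)
one : {k : ℕ} → Subset (suc k)
one = ⁅ zero ⁆

two : {k : ℕ} → Subset (suc k)
two = shift one

-- membership in F_n : no two consecutive integers
noConsec : {m : ℕ} → Vec Bool m → Bool
noConsec []               = true
noConsec (x ∷ [])         = true
noConsec (x ∷ y ∷ xs)     = not (x ∧ y) ∧ noConsec (y ∷ xs)

Des : {k : ℕ} → Vec ℤ (suc (suc k)) → DSet k
Des {k} w = ( (lookup w (suc zero) <ℤ - lookup w zero)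
            , tabulate (λ (i : Fin (suc k)) → lookup w (suc i) <ℤ lookup w (inject₁ i)) )

Peak : {k : ℕ} → Vec ℕ (suc (suc k)) → Subset (suc k)
Peak {k} u = tabulate (λ (i : Fin (suc k)) →
                 (lookup u′ (inject₁ (inject₁ i)) <ᵇ lookup u′ (inject₁ (suc i)))
               ∧ (lookup u′ (suc (suc i)) <ᵇ lookup u′ (inject₁ (suc i))))
  where
  u′ : Vec ℕ (suc (suc (suc k)))
  u′ = 0 ∷ u      -- convention u₀ = 0

Y : (k : ℕ) → DSet k → List (Vec ℤ (suc (suc k)))
Y k J = filterᵇ (λ w → eqD (Des w) J) (Dn (suc (suc k)))

X : (k : ℕ) → DSet k → List (Vec ℤ (suc (suc k)))
X k J = concatMap (Y k) (filterᵇ (λ I → subD I J) (allDSets k))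

P : (k : ℕ) → Subset (suc k) → List (Vec ℕ (suc (suc k)))
P k F = filterᵇ (λ u → eqBs (Peak u) F) (Sn (suc (suc k)))

ψ : {n : ℕ} → List (Vec ℤ n) → List (Vec ℕ n)
ψ = map (Vec.map ∣_∣)

sumA : (k : ℕ) → Subset (suc k) → List (Vec ℕ (suc (suc k)))
sumA k S = concatMap (λ F → (2 ^ card F) · P k F)
             (filterᵇ (λ F → noConsec F ∧ subᵇ F S) (allSubsets (suc k)))

sumB : (k : ℕ) → Subset (suc k) → List (Vec ℕ (suc (suc k)))
sumB k S = concatMap (λ F → (2 ^ card F) · P k (one ∪ F))
             (filterᵇ (λ F → noConsec (one ∪ F) ∧ subᵇ F S) (allSubsets (suc k)))

sumC : (k : ℕ) → Subset (suc k) → List (Vec ℕ (suc (suc k)))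
sumC k S = concatMap (λ F → P k F)
             (filterᵇ (λ F → noConsec F ∧ subᵇ F S) (allSubsets (suc k)))

{-# OPTIONS --safe #-}
-- Both sides are written as Σ_u c(u)·u over u ∈ S_n and compared coefficientwise.
-- Fix u and sign its entries to get w.  Where u ascends, w has a descent iff the
-- right entry is negative; where u descends, iff the left entry is positive.  So
-- each descent is decided by the sign of the larger of its two entries: a peak of u
-- decides two adjacent descents in opposite ways, a valley decides none, any other
-- entry decides one.  Walking along u (preceded by 0), the signs giving the type-B
-- descent set J number 2^#Peak(u) if Peak(u) ⊆ J △ (J+1) and 0 otherwise, and those
-- giving a descent set inside J number 2^#J if Peak(u) ⊆ J ∪ (J+1).  In D_n only
-- even sign vectors count; as the sign at a valley decides no descent, exactly half
-- of the sign vectors with a given descent pattern are even.  The descents 1′ and 1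
-- are decided by the first two entries: both by the sign of w₂ when u₁ < u₂, and in
-- opposite ways by the sign of w₁ when u₁ > u₂.
module Submission where

open import Defs
open import Data.Bool using (Bool; true; false; _∧_; _∨_; not; _xor_; T)
open import Data.Bool.Properties using (∧-zeroʳ; ∧-assoc; ∧-idem; ∧-identityʳ; ∧-inverseʳ; ∨-zeroʳ; not-involutive; not-distribˡ-xor; not-distribʳ-xor; T-≡)
open import Data.Empty using (⊥-elim)
open import Data.Fin using (zero; suc; inject₁)
open import Data.Fin.Subset using (Subset; _∪_; ⊥)
open import Data.Fin.Subset.Properties using (∪-identityˡ; ∪-identityʳ)
open import Data.Integer as ℤ using (ℤ; -_; ∣_∣)
open import Data.Integer.Properties using (neg-involutive; ∣-i∣≡∣i∣)
open import Data.List using (List; []; _∷_; _++_; map; concatMap; filterᵇ; replicate)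
import Data.List.Properties as List
open import Data.List.Relation.Unary.All using (All; []; _∷_)
import Data.List.Relation.Unary.All as All
import Data.List.Relation.Unary.All.Properties as All
open import Data.List.Relation.Binary.Permutation.Propositional using (_↭_; ↭-refl; ↭-trans; ↭-reflexive; ↭-sym)
open import Data.List.Relation.Binary.Permutation.Propositional.Properties using (++⁺; ++⁺ˡ; shifts)
open import Data.Nat using (ℕ; zero; suc; _+_; _*_; _^_; _<_; _≤_; _<ᵇ_; _≤ᵇ_; s≤s; z≤n)
open import Data.Nat.ListAction using (sum)
open import Data.Nat.Properties
open import Algebra.Properties.CommutativeSemigroup +-commutativeSemigroup using (interchange)
open import Algebra.Properties.CommutativeSemigroup *-commutativeSemigroup using () renaming (x∙yz≈y∙xz to *-left-comm)
open import Data.Product using (_×_; _,_; proj₁)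
open import Data.Unit using (⊤; tt)
open import Data.Vec as Vec using (Vec; []; _∷_; lookup; tabulate; insertAt; toList; allFin)
import Data.Vec.Relation.Unary.All as AllV
open import Function using (_∘_; Equivalence)
open import Relation.Nullary.Decidable using (T?)
open import Relation.Binary using (tri<; tri≈; tri>)
open import Relation.Binary.PropositionalEquality
open ≡-Reasoning

𝟙 : Bool → ℕ
𝟙 false = 0
𝟙 true  = 1

𝟙-∧ : ∀ a b → 𝟙 (a ∧ b) ≡ 𝟙 a * 𝟙 b
𝟙-∧ false b = refl
𝟙-∧ true  b = sym (+-identityʳ (𝟙 b))

𝟙-∧-* : ∀ q s n → 𝟙 (q ∧ s) * n ≡ 𝟙 q * (𝟙 s * n)
𝟙-∧-* false s n = refl
𝟙-∧-* true  s n = sym (*-identityˡ _)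

n+n≡2*n : ∀ n → n + n ≡ 2 * n
n+n≡2*n n = cong (n +_) (sym (+-identityʳ n))

𝟙-not-pair : ∀ q n → 𝟙 q * n + 𝟙 (not q) * n ≡ n
𝟙-not-pair false n = +-identityʳ n
𝟙-not-pair true  n = trans (+-identityʳ _) (+-identityʳ n)

𝟙+1 : ∀ a → 𝟙 a + 1 ≡ 2 ^ 𝟙 a
𝟙+1 false = refl
𝟙+1 true  = refl

<ᵇ-true : ∀ {m n} → m < n → (m <ᵇ n) ≡ true
<ᵇ-true m<n = Equivalence.to T-≡ (<⇒<ᵇ m<n)

<ᵇ-false : ∀ {m n} → n ≤ m → (m <ᵇ n) ≡ false
<ᵇ-false {m} {n} n≤m with m <ᵇ n in eq
... | false = refl
... | true  = ⊥-elim (≤⇒≯ n≤m (<ᵇ⇒< m n (subst T (sym eq) tt)))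

≤ᵇ-true : ∀ {m n} → m ≤ n → (m ≤ᵇ n) ≡ true
≤ᵇ-true m≤n = Equivalence.to T-≡ (≤⇒≤ᵇ m≤n)

≤ᵇ-false : ∀ {m n} → n < m → (m ≤ᵇ n) ≡ false
≤ᵇ-false {suc m} (s≤s n≤m) = <ᵇ-false n≤m

∑ : (m : ℕ) → (Vec Bool m → ℕ) → ℕ
∑ zero    f = f []
∑ (suc m) f = ∑ m (λ t → f (false ∷ t) + f (true ∷ t))

∑-cong : ∀ m {f g : Vec Bool m → ℕ} → (∀ t → f t ≡ g t) → ∑ m f ≡ ∑ m g
∑-cong zero    f≗g = f≗g []
∑-cong (suc m) f≗g = ∑-cong m (λ t → cong₂ _+_ (f≗g (false ∷ t)) (f≗g (true ∷ t)))

∑-zero : ∀ m → ∑ m (λ _ → 0) ≡ 0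
∑-zero zero    = refl
∑-zero (suc m) = ∑-zero m

∑-distrib-+ : ∀ m (f g : Vec Bool m → ℕ) → ∑ m (λ t → f t + g t) ≡ ∑ m f + ∑ m g
∑-distrib-+ zero    f g = refl
∑-distrib-+ (suc m) f g =
  trans (∑-cong m (λ t → interchange (f (false ∷ t)) (g (false ∷ t)) (f (true ∷ t)) (g (true ∷ t))))
        (∑-distrib-+ m _ _)

∑-distribˡ-* : ∀ m c (f : Vec Bool m → ℕ) → ∑ m (λ t → c * f t) ≡ c * ∑ m f
∑-distribˡ-* zero    c f = refl
∑-distribˡ-* (suc m) c f =
  trans (∑-cong m (λ t → sym (*-distribˡ-+ c (f (false ∷ t)) (f (true ∷ t))))) (∑-distribˡ-* m c _)

∑-δ : ∀ m (S : Vec Bool m) (g : Vec Bool m → ℕ) → ∑ m (λ t → g t * 𝟙 (eqBs S t)) ≡ g S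
∑-δ zero    []          g = *-identityʳ (g [])
∑-δ (suc m) (false ∷ S) g =
  trans (∑-cong m (λ t → trans (cong ((g (false ∷ t) * 𝟙 (eqBs S t)) +_) (*-zeroʳ (g (true ∷ t)))) (+-identityʳ _)))
        (∑-δ m S (g ∘ (false ∷_)))
∑-δ (suc m) (true ∷ S)  g =
  trans (∑-cong m (λ t → cong (_+ g (true ∷ t) * 𝟙 (eqBs S t)) (*-zeroʳ (g (false ∷ t)))))
        (∑-δ m S (g ∘ (true ∷_)))

sum-∑-comm : ∀ {A : Set} m (xs : List A) (f : A → Vec Bool m → ℕ) →
             sum (map (λ x → ∑ m (f x)) xs) ≡ ∑ m (λ t → sum (map (λ x → f x t) xs))
sum-∑-comm m []       f = sym (∑-zero m)
sum-∑-comm m (x ∷ xs) f = trans (cong (∑ m (f x) +_) (sum-∑-comm m xs f)) (sym (∑-distrib-+ m (f x) _))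

sum-map-filterᵇ : {A : Set} (q : A → Bool) (h : A → ℕ) (xs : List A) →
                  sum (map h (filterᵇ q xs)) ≡ sum (map (λ x → 𝟙 (q x) * h x) xs)
sum-map-filterᵇ q h []       = refl
sum-map-filterᵇ q h (x ∷ xs) with q x
... | true  = cong₂ _+_ (sym (+-identityʳ (h x))) (sum-map-filterᵇ q h xs)
... | false = sum-map-filterᵇ q h xs

sum-concatMap-pair : {A B : Set} (f g : A → B) (h : B → ℕ) (xs : List A) →
  sum (map h (concatMap (λ x → f x ∷ g x ∷ []) xs)) ≡ sum (map (λ x → h (f x) + h (g x)) xs)
sum-concatMap-pair f g h []       = refl
sum-concatMap-pair f g h (x ∷ xs) =
  trans (sym (+-assoc (h (f x)) (h (g x)) _)) (cong (h (f x) + h (g x) +_) (sum-concatMap-pair f g h xs))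

sum-allSubsets : ∀ m (f : Vec Bool m → ℕ) → sum (map f (allSubsets m)) ≡ ∑ m f
sum-allSubsets zero    f = +-identityʳ (f [])
sum-allSubsets (suc m) f = trans (sum-concatMap-pair (false ∷_) (true ∷_) f (allSubsets m)) (sum-allSubsets m _)

sum-allDSets : ∀ k (h : DSet k → ℕ) → sum (map h (allDSets k)) ≡ ∑ (suc (suc k)) (h ∘ Vec.uncons)
sum-allDSets k h = trans (sum-concatMap-pair (false ,_) (true ,_) h (allSubsets (suc k))) (sum-allSubsets (suc k) _)

sum-filterᵇ-δ : ∀ m (q : Vec Bool m → Bool) (w : Vec Bool m → ℕ) (S : Vec Bool m) →
                sum (map (λ F → w F * 𝟙 (eqBs S F)) (filterᵇ q (allSubsets m))) ≡ 𝟙 (q S) * w S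
sum-filterᵇ-δ m q w S = begin
  sum (map (λ F → w F * 𝟙 (eqBs S F)) (filterᵇ q (allSubsets m)))  ≡⟨ sum-map-filterᵇ q _ (allSubsets m) ⟩
  sum (map (λ F → 𝟙 (q F) * (w F * 𝟙 (eqBs S F))) (allSubsets m))  ≡⟨ sum-allSubsets m _ ⟩
  ∑ m (λ F → 𝟙 (q F) * (w F * 𝟙 (eqBs S F)))                        ≡⟨ ∑-cong m (λ F → sym (*-assoc (𝟙 (q F)) (w F) _)) ⟩
  ∑ m (λ F → 𝟙 (q F) * w F * 𝟙 (eqBs S F))                          ≡⟨ ∑-δ m S (λ F → 𝟙 (q F) * w F) ⟩
  𝟙 (q S) * w S                                                      ∎

sum-filterᵇ-δ-DSet : ∀ k (q : DSet k → Bool) (w : DSet k → ℕ) (D : DSet k) →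
                     sum (map (λ I → w I * 𝟙 (eqD D I)) (filterᵇ q (allDSets k))) ≡ 𝟙 (q D) * w D
sum-filterᵇ-δ-DSet k q w (d , S) = begin
  sum (map (λ I → w I * 𝟙 (eqD (d , S) I)) (filterᵇ q (allDSets k)))
    ≡⟨ sum-map-filterᵇ q (λ I → w I * 𝟙 (eqD (d , S) I)) (allDSets k) ⟩
  sum (map (λ I → 𝟙 (q I) * (w I * 𝟙 (eqD (d , S) I))) (allDSets k))
    ≡⟨ sum-allDSets k (λ I → 𝟙 (q I) * (w I * 𝟙 (eqD (d , S) I))) ⟩
  ∑ (suc (suc k)) (λ t → 𝟙 (q (Vec.uncons t)) * (w (Vec.uncons t) * 𝟙 (eqD (d , S) (Vec.uncons t))))
    ≡⟨ ∑-cong (suc (suc k)) (λ t → sym (*-assoc (𝟙 (q (Vec.uncons t))) (w (Vec.uncons t)) (𝟙 (eqD (d , S) (Vec.uncons t))))) ⟩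
  ∑ (suc (suc k)) (λ t → 𝟙 (q (Vec.uncons t)) * w (Vec.uncons t) * 𝟙 (eqD (d , S) (Vec.uncons t)))
    -- definitionally eqD (d , S) (b , t) = eqBs (d ∷ S) (b ∷ t)
    ≡⟨ ∑-δ (suc (suc k)) (d ∷ S) (λ t → 𝟙 (q (Vec.uncons t)) * w (Vec.uncons t)) ⟩
  𝟙 (q (d , S)) * w (d , S)
    ∎

filterᵇ-filterᵇ : {A : Set} (p q : A → Bool) (xs : List A) → filterᵇ q (filterᵇ p xs) ≡ filterᵇ (λ x → p x ∧ q x) xs
filterᵇ-filterᵇ p q []       = refl
filterᵇ-filterᵇ p q (x ∷ xs) with p x
... | false = filterᵇ-filterᵇ p q xs
... | true  with q x
...   | true  = cong (x ∷_) (filterᵇ-filterᵇ p q xs)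
...   | false = filterᵇ-filterᵇ p q xs

-- Formal sums as weighted lists

weighted : {A : Set} → (A → ℕ) → List A → List A
weighted f = concatMap (λ u → replicate (f u) u)

filterᵇ-weighted : {A : Set} (p : A → Bool) (L : List A) → filterᵇ p L ≡ weighted (𝟙 ∘ p) L
filterᵇ-weighted p []      = refl
filterᵇ-weighted p (u ∷ L) with p u
... | true  = cong (u ∷_) (filterᵇ-weighted p L)
... | false = filterᵇ-weighted p L

weighted-cong : {A : Set} {f g : A → ℕ} {L : List A} → All (λ u → f u ≡ g u) L → weighted f L ≡ weighted g L
weighted-cong              []           = refl
weighted-cong {L = u ∷ _} (f≡g ∷ f≡gs) = cong₂ (λ n rest → replicate n u ++ rest) f≡g (weighted-cong f≡gs)

weighted-zero : {A : Set} (L : List A) → weighted (λ _ → 0) L ≡ []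
weighted-zero []      = refl
weighted-zero (u ∷ L) = weighted-zero L

replicate-++ : {A : Set} (a b : ℕ) (x : A) → replicate a x ++ replicate b x ≡ replicate (a + b) x
replicate-++ zero    b x = refl
replicate-++ (suc a) b x = cong (x ∷_) (replicate-++ a b x)

weighted-++ : {A : Set} (f g : A → ℕ) (L : List A) → weighted f L ++ weighted g L ↭ weighted (λ u → f u + g u) L
weighted-++ f g []      = ↭-refl
weighted-++ f g (u ∷ L) =
  ↭-trans (↭-reflexive (List.++-assoc (replicate (f u) u) (weighted f L) _))
  (↭-trans (++⁺ˡ (replicate (f u) u) (shifts (weighted f L) (replicate (g u) u)))
  (↭-trans (↭-reflexive (trans (sym (List.++-assoc (replicate (f u) u) (replicate (g u) u) _))
                               (cong (_++ _) (replicate-++ (f u) (g u) u))))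
  (++⁺ˡ (replicate (f u + g u) u) (weighted-++ f g L))))

·-weighted : {A : Set} (c : ℕ) (f : A → ℕ) (L : List A) → c · weighted f L ↭ weighted (λ u → c * f u) L
·-weighted zero    f L = ↭-reflexive (sym (weighted-zero L))
·-weighted (suc c) f L = ↭-trans (++⁺ˡ (weighted f L) (·-weighted c f L)) (weighted-++ f (λ u → c * f u) L)

·-↭ : {A : Set} (c : ℕ) {xs ys : List A} → xs ↭ ys → c · xs ↭ c · ys
·-↭ zero    xs↭ys = ↭-refl
·-↭ (suc c) xs↭ys = ++⁺ xs↭ys (·-↭ c xs↭ys)

concatMap-weighted : {A B : Set} (Q : B → List A) (h : B → A → ℕ) (L : List A) (Fs : List B) →
  (∀ F → Q F ↭ weighted (h F) L) → concatMap Q Fs ↭ weighted (λ u → sum (map (λ F → h F u) Fs)) L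
concatMap-weighted Q h L []       _  = ↭-reflexive (sym (weighted-zero L))
concatMap-weighted Q h L (F ∷ Fs) QF = ↭-trans (++⁺ (QF F) (concatMap-weighted Q h L Fs QF)) (weighted-++ (h F) _ L)

signed : Bool → ℕ → ℤ
signed false x = ℤ.+ x
signed true  x = - ℤ.+ x

signWith : ∀ {m} → Vec Bool m → Vec ℕ m → Vec ℤ m
signWith = Vec.zipWith signed

∣signWith∣ : ∀ {m} (s : Vec Bool m) (u : Vec ℕ m) → Vec.map ∣_∣ (signWith s u) ≡ u
∣signWith∣ []          []      = refl
∣signWith∣ (false ∷ s) (x ∷ u) = cong (x ∷_) (∣signWith∣ s u)
∣signWith∣ (true  ∷ s) (x ∷ u) = cong₂ _∷_ (∣-i∣≡∣i∣ (ℤ.+ x)) (∣signWith∣ s u)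

signings-allSubsets : ∀ {m} (u : Vec ℕ m) → signings u ≡ map (λ s → signWith s u) (allSubsets m)
signings-allSubsets []            = refl
signings-allSubsets {suc m} (x ∷ u) =
  trans (cong (concatMap signsOf) (signings-allSubsets u))
        (trans (List.concatMap-map signsOf (λ s → signWith s u) (allSubsets m))
               (sym (List.map-concatMap (λ s → signWith s (x ∷ u)) (λ s → (false ∷ s) ∷ (true ∷ s) ∷ []) (allSubsets m))))
  where
  signsOf : Vec ℤ m → List (Vec ℤ (suc m))
  signsOf ws = (ℤ.+ x ∷ ws) ∷ (- ℤ.+ x ∷ ws) ∷ []

ψ-filterᵇ-signWith : ∀ {m} (p : Vec ℤ m → Bool) (u : Vec ℕ m) (ss : List (Vec Bool m)) →
  ψ (filterᵇ p (map (λ s → signWith s u) ss)) ≡ replicate (sum (map (λ s → 𝟙 (p (signWith s u))) ss)) u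
ψ-filterᵇ-signWith p u []       = refl
ψ-filterᵇ-signWith p u (s ∷ ss) with p (signWith s u)
... | true  = cong₂ _∷_ (∣signWith∣ s u) (ψ-filterᵇ-signWith p u ss)
... | false = ψ-filterᵇ-signWith p u ss

ψ-filterᵇ-signings : ∀ {m} (p : Vec ℤ m → Bool) (L : List (Vec ℕ m)) →
  ψ (filterᵇ p (concatMap signings L)) ≡ weighted (λ u → ∑ m (λ s → 𝟙 (p (signWith s u)))) L
ψ-filterᵇ-signings p []            = refl
ψ-filterᵇ-signings {m} p (u ∷ L) = begin
  ψ (filterᵇ p (signings u ++ concatMap signings L))
    ≡⟨ cong ψ (List.filter-++ (T? ∘ p) (signings u) _) ⟩
  ψ (filterᵇ p (signings u) ++ filterᵇ p (concatMap signings L))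
    ≡⟨ List.map-++ (Vec.map ∣_∣) (filterᵇ p (signings u)) _ ⟩
  ψ (filterᵇ p (signings u)) ++ ψ (filterᵇ p (concatMap signings L))
    ≡⟨ cong₂ _++_ signings-u (ψ-filterᵇ-signings p L) ⟩
  replicate (∑ m (λ s → 𝟙 (p (signWith s u)))) u ++ weighted (λ u → ∑ m (λ s → 𝟙 (p (signWith s u)))) L ∎
  where
  signings-u : ψ (filterᵇ p (signings u)) ≡ replicate (∑ m (λ s → 𝟙 (p (signWith s u)))) u
  signings-u = begin
    ψ (filterᵇ p (signings u))                                          ≡⟨ cong (ψ ∘ filterᵇ p) (signings-allSubsets u) ⟩
    ψ (filterᵇ p (map (λ s → signWith s u) (allSubsets m)))             ≡⟨ ψ-filterᵇ-signWith p u (allSubsets m) ⟩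
    replicate (sum (map (λ s → 𝟙 (p (signWith s u))) (allSubsets m))) u ≡⟨ cong (λ n → replicate n u) (sum-allSubsets m _) ⟩
    replicate (∑ m (λ s → 𝟙 (p (signWith s u)))) u                      ∎

signed-ascent : ∀ σ τ {x y} → 0 < x → x < y → (signed τ y <ℤ signed σ x) ≡ τ
signed-ascent false false                 _ x<y       = cong not (≤ᵇ-true (<⇒≤ x<y))
signed-ascent true  false {suc x}         _ _         = refl
signed-ascent false true  {y = suc y}     _ _         = refl
signed-ascent true  true  {suc x} {suc y} _ (s≤s x<y) = cong not (≤ᵇ-false x<y)

signed-descent : ∀ σ τ {x y} → 0 < y → y < x → (signed τ y <ℤ signed σ x) ≡ not σ
signed-descent false false                 _ y<x       = cong not (≤ᵇ-false y<x)
signed-descent true  false {suc x}         _ _         = refl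
signed-descent false true  {y = suc y}     _ _         = refl
signed-descent true  true  {suc x} {suc y} _ (s≤s y<x) = cong not (≤ᵇ-true (<⇒≤ y<x))

negate-signed : ∀ σ x → - signed σ x ≡ signed (not σ) x
negate-signed false x = refl
negate-signed true  x = neg-involutive (ℤ.+ x)

descents : ∀ {m} → Vec ℤ (suc m) → Vec Bool m
descents (x ∷ [])    = []
descents (x ∷ y ∷ w) = (y <ℤ x) ∷ descents (y ∷ w)

descent′ : ∀ {m} → Vec ℤ (suc (suc m)) → Bool
descent′ (x ∷ y ∷ _) = y <ℤ - x

tabulate-descents : ∀ {m} (w : Vec ℤ (suc m)) →
                    tabulate (λ i → lookup w (suc i) <ℤ lookup w (inject₁ i)) ≡ descents w
tabulate-descents {zero}  (x ∷ [])    = refl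
tabulate-descents {suc m} (x ∷ y ∷ w) = cong ((y <ℤ x) ∷_) (tabulate-descents (y ∷ w))

Des≡ : ∀ {k} (w : Vec ℤ (suc (suc k))) → Des w ≡ (descent′ w , descents w)
Des≡ (x ∷ y ∷ w) = cong ((y <ℤ - x) ,_) (tabulate-descents (x ∷ y ∷ w))

isPeak : ℕ → ℕ → ℕ → Bool
isPeak p x y = (p <ᵇ x) ∧ (y <ᵇ x)

isPeak-ascent : ∀ p {x y} → x < y → isPeak p x y ≡ false
isPeak-ascent p {x} x<y rewrite <ᵇ-false (<⇒≤ x<y) = ∧-zeroʳ (p <ᵇ x)

isPeak-below : ∀ {p x} y → x < p → isPeak p x y ≡ false
isPeak-below y x<p rewrite <ᵇ-false (<⇒≤ x<p) = refl

isPeak-peak : ∀ {p x y} → p < x → y < x → isPeak p x y ≡ true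
isPeak-peak p<x y<x rewrite <ᵇ-true p<x | <ᵇ-true y<x = refl

isPeak-adjacent : ∀ a b c d → isPeak a b c ∧ isPeak b c d ≡ false
isPeak-adjacent a b c d with a <ᵇ b | c <ᵇ b in c<b | b <ᵇ c in b<c
... | false | _     | _     = refl
... | true  | false | _     = refl
... | true  | true  | false = refl
... | true  | true  | true  = ⊥-elim (<-asym (<ᵇ⇒< c b (subst T (sym c<b) tt)) (<ᵇ⇒< b c (subst T (sym b<c) tt)))

peaks : ∀ {m} → Vec ℕ (suc (suc m)) → Vec Bool m
peaks (p ∷ x ∷ [])    = []
peaks (p ∷ x ∷ y ∷ w) = isPeak p x y ∷ peaks (x ∷ y ∷ w)

tabulate-peaks : ∀ {k} (w : Vec ℕ (suc (suc (suc k)))) →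
  tabulate (λ i → isPeak (lookup w (inject₁ (inject₁ i))) (lookup w (inject₁ (suc i))) (lookup w (suc (suc i)))) ≡ peaks w
tabulate-peaks {zero}  (p ∷ x ∷ y ∷ [])    = refl
tabulate-peaks {suc k} (p ∷ x ∷ y ∷ z ∷ w) = cong (isPeak p x y ∷_) (tabulate-peaks (x ∷ y ∷ z ∷ w))

Peak≡peaks : ∀ {k} (u : Vec ℕ (suc (suc k))) → Peak u ≡ peaks (0 ∷ u)
Peak≡peaks u = tabulate-peaks (0 ∷ u)

noConsec-peaks : ∀ {m} (w : Vec ℕ (suc (suc m))) → noConsec (peaks w) ≡ true
noConsec-peaks (a ∷ b ∷ [])         = refl
noConsec-peaks (a ∷ b ∷ c ∷ [])     = refl
noConsec-peaks (a ∷ b ∷ c ∷ d ∷ w) =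
  cong₂ _∧_ (cong not (isPeak-adjacent a b c d)) (noConsec-peaks (b ∷ c ∷ d ∷ w))

Admissible : ∀ {m} → ℕ → Vec ℕ m → Set
Admissible p []      = ⊤
Admissible p (x ∷ v) = p ≢ x × 0 < x × Admissible x v

Admissible-relabel : ∀ {m p q} (v : Vec ℕ m) → Admissible p v → AllV.All (_< q) v → Admissible q v
Admissible-relabel []      _               _              = tt
Admissible-relabel (x ∷ v) (_ , 0<x , adm) (x<q AllV.∷ _) = >⇒≢ x<q , 0<x , adm

insertAt-admissible : ∀ {m} q (v : Vec ℕ m) i n → Admissible q v → AllV.All (_≤ n) v → q ≤ n →
                      Admissible q (insertAt v i (suc n))
insertAt-admissible q v       zero    n adm v≤n q≤n =
  <⇒≢ (s≤s q≤n) , s≤s z≤n , Admissible-relabel v adm (AllV.map s≤s v≤n)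
insertAt-admissible q (x ∷ v) (suc i) n (q≢x , 0<x , adm) (x≤n AllV.∷ v≤n) _ =
  q≢x , 0<x , insertAt-admissible x v i n adm v≤n x≤n

insertAt-bounded : ∀ {m} (v : Vec ℕ m) i n → AllV.All (_≤ n) v → AllV.All (_≤ suc n) (insertAt v i (suc n))
insertAt-bounded v       zero    n v≤n              = ≤-refl AllV.∷ AllV.map m≤n⇒m≤1+n v≤n
insertAt-bounded (x ∷ v) (suc i) n (x≤n AllV.∷ v≤n) = m≤n⇒m≤1+n x≤n AllV.∷ insertAt-bounded v i n v≤n

Sn-admissible-bounded : ∀ n → All (λ u → Admissible 0 u × AllV.All (_≤ n) u) (Sn n)
Sn-admissible-bounded zero    = (tt , AllV.[]) ∷ []
Sn-admissible-bounded (suc n) = All.concat⁺ (All.map⁺ (All.map insertions (Sn-admissible-bounded n)))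
  where
  insertions : ∀ {v} → Admissible 0 v × AllV.All (_≤ n) v →
               All (λ u → Admissible 0 u × AllV.All (_≤ suc n) u) (map (λ i → insertAt v i (suc n)) (toList (allFin (suc n))))
  insertions {v} (adm , v≤n) =
    All.map⁺ (All.universal inserted (toList (allFin (suc n))))
    where
    inserted : ∀ i → Admissible 0 (insertAt v i (suc n)) × AllV.All (_≤ suc n) (insertAt v i (suc n))
    inserted i = insertAt-admissible 0 v i n adm v≤n z≤n , insertAt-bounded v i n v≤n

Sn-admissible : ∀ n → All (Admissible 0) (Sn n)
Sn-admissible n = All.map (λ (adm , _) → adm) (Sn-admissible-bounded n)

negCount-signWith : ∀ {m p} (s : Vec Bool m) (u : Vec ℕ m) → Admissible p u → negCount (signWith s u) ≡ card s
negCount-signWith []          []      _                   = refl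
negCount-signWith (false ∷ s) (x ∷ u) (_ , s≤s z≤n , adm) = negCount-signWith s u adm
negCount-signWith (true  ∷ s) (x ∷ u) (_ , s≤s z≤n , adm) = cong suc (negCount-signWith s u adm)

-- Type B: counting signs by their descent set

pointwise : (Bool → Bool → Bool) → ∀ {m} → Vec Bool m → Vec Bool m → Bool
pointwise c []      []      = true
pointwise c (d ∷ D) (a ∷ J) = c d a ∧ pointwise c D J

_⇔ᵇ_ : Bool → Bool → Bool
d ⇔ᵇ a = not (d xor a)

_⇒ᵇ_ : Bool → Bool → Bool
d ⇒ᵇ a = not d ∨ a

eqBs≡pointwise : ∀ {m} (D J : Vec Bool m) → eqBs D J ≡ pointwise _⇔ᵇ_ D J
eqBs≡pointwise []      []      = refl
eqBs≡pointwise (d ∷ D) (a ∷ J) = cong ((d ⇔ᵇ a) ∧_) (eqBs≡pointwise D J)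

subᵇ≡pointwise : ∀ {m} (D J : Vec Bool m) → subᵇ D J ≡ pointwise _⇒ᵇ_ D J
subᵇ≡pointwise []      []      = refl
subᵇ≡pointwise (d ∷ D) (a ∷ J) = cong ((d ⇒ᵇ a) ∧_) (subᵇ≡pointwise D J)

-- xorShifted b J = J △ (J + 1), with b shifted in at the front; orShifted likewise for ∪.
xorShifted : ∀ {m} → Bool → Vec Bool m → Vec Bool m
xorShifted b []      = []
xorShifted b (a ∷ J) = (a xor b) ∷ xorShifted a J

orShifted : ∀ {m} → Bool → Vec Bool m → Vec Bool m
orShifted b []      = []
orShifted b (a ∷ J) = (a ∨ b) ∷ orShifted a J

⇔ᵇ-select : ∀ a (f : Bool → ℕ) → 𝟙 (false ⇔ᵇ a) * f false + 𝟙 (true ⇔ᵇ a) * f true ≡ f a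
⇔ᵇ-select false f = trans (+-identityʳ _) (+-identityʳ (f false))
⇔ᵇ-select true  f = +-identityʳ (f true)

not-⇔ᵇ : ∀ σ a → (not σ ⇔ᵇ a) ≡ a xor σ
not-⇔ᵇ false false = refl
not-⇔ᵇ false true  = refl
not-⇔ᵇ true  false = refl
not-⇔ᵇ true  true  = refl

𝟙-xor-pair : ∀ a n → 𝟙 (a xor false) * n + 𝟙 (a xor true) * n ≡ n
𝟙-xor-pair false n = +-identityʳ n
𝟙-xor-pair true  n = trans (+-identityʳ _) (+-identityʳ n)

-- c = _⇔ᵇ_ asks for the descent set J itself, c = _⇒ᵇ_ for a subset of J.
matches : (Bool → Bool → Bool) → ∀ {m} → Vec ℕ (suc m) → Vec Bool m → Vec Bool (suc m) → ℕ
matches c v J s = 𝟙 (pointwise c (descents (signWith s v)) J)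

countB : (Bool → Bool → Bool) → Bool → ∀ {m} → Vec ℕ (suc m) → Vec Bool m → ℕ
countB c σ {m} v J = ∑ m (λ t → matches c v J (σ ∷ t))

countB± : (Bool → Bool → Bool) → ∀ {m} → Vec ℕ (suc m) → Vec Bool m → ℕ
countB± c v J = countB c false v J + countB c true v J

countB-step : ∀ c σ {m} x y (r : Vec ℕ m) a J →
  countB c σ (x ∷ y ∷ r) (a ∷ J) ≡ 𝟙 (c (signed false y <ℤ signed σ x) a) * countB c false (y ∷ r) J
                                 + 𝟙 (c (signed true  y <ℤ signed σ x) a) * countB c true  (y ∷ r) J
countB-step c σ {m} x y r a J = begin
  ∑ m (λ t → 𝟙 (c (d false) a ∧ R false t) + 𝟙 (c (d true) a ∧ R true t))
    ≡⟨ ∑-cong m (λ t → cong₂ _+_ (𝟙-∧ (c (d false) a) (R false t)) (𝟙-∧ (c (d true) a) (R true t))) ⟩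
  ∑ m (λ t → 𝟙 (c (d false) a) * 𝟙 (R false t) + 𝟙 (c (d true) a) * 𝟙 (R true t))
    ≡⟨ ∑-distrib-+ m _ _ ⟩
  ∑ m (λ t → 𝟙 (c (d false) a) * 𝟙 (R false t)) + ∑ m (λ t → 𝟙 (c (d true) a) * 𝟙 (R true t))
    ≡⟨ cong₂ _+_ (∑-distribˡ-* m (𝟙 (c (d false) a)) (𝟙 ∘ R false)) (∑-distribˡ-* m (𝟙 (c (d true) a)) (𝟙 ∘ R true)) ⟩
  𝟙 (c (d false) a) * countB c false (y ∷ r) J + 𝟙 (c (d true) a) * countB c true (y ∷ r) J
    ∎
  where
  d : Bool → Bool
  d τ = signed τ y <ℤ signed σ x
  R : Bool → Vec Bool m → Bool
  R τ t = pointwise c (descents (signWith (τ ∷ t) (y ∷ r))) J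

countB-ascent : ∀ c σ {m x y} (r : Vec ℕ m) a J → 0 < x → x < y →
  countB c σ (x ∷ y ∷ r) (a ∷ J) ≡ 𝟙 (c false a) * countB c false (y ∷ r) J + 𝟙 (c true a) * countB c true (y ∷ r) J
countB-ascent c σ {x = x} {y} r a J 0<x x<y =
  trans (countB-step c σ x y r a J)
        (cong₂ (λ d e → 𝟙 (c d a) * countB c false (y ∷ r) J + 𝟙 (c e a) * countB c true (y ∷ r) J)
               (signed-ascent σ false 0<x x<y) (signed-ascent σ true 0<x x<y))

countB-descent : ∀ c σ {m x y} (r : Vec ℕ m) a J → 0 < y → y < x →
  countB c σ (x ∷ y ∷ r) (a ∷ J) ≡ 𝟙 (c (not σ) a) * countB± c (y ∷ r) J
countB-descent c σ {x = x} {y} r a J 0<y y<x =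
  trans (countB-step c σ x y r a J)
        (trans (cong₂ (λ d e → 𝟙 (c d a) * countB c false (y ∷ r) J + 𝟙 (c e a) * countB c true (y ∷ r) J)
                      (signed-descent σ false 0<y y<x) (signed-descent σ true 0<y y<x))
               (sym (*-distribˡ-+ (𝟙 (c (not σ) a)) _ _)))

weightY : ∀ {m} → ℕ → Bool → Vec ℕ (suc m) → Vec Bool m → ℕ
weightY p b v J = 𝟙 (subᵇ (peaks (p ∷ v)) (xorShifted b J)) * 2 ^ card (peaks (p ∷ v))

weightY-flat : ∀ p b {m} x y (r : Vec ℕ m) a J → isPeak p x y ≡ false →
               weightY p b (x ∷ y ∷ r) (a ∷ J) ≡ weightY x a (y ∷ r) J
weightY-flat p b x y r a J notPeak rewrite notPeak = refl

weightY-peak : ∀ p b {m} x y (r : Vec ℕ m) a J → isPeak p x y ≡ true →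
               weightY p b (x ∷ y ∷ r) (a ∷ J) ≡ 𝟙 (a xor b) * (2 * weightY x a (y ∷ r) J)
weightY-peak p b x y r a J peak rewrite peak =
  trans (𝟙-∧-* (a xor b) _ _)
        (cong (𝟙 (a xor b) *_) (*-left-comm (𝟙 (subᵇ (peaks (x ∷ y ∷ r)) (xorShifted a J))) 2 (2 ^ card (peaks (x ∷ y ∷ r)))))

weightX : ∀ {m} → ℕ → Bool → Vec ℕ (suc m) → Vec Bool m → ℕ
weightX p b v J = 𝟙 (subᵇ (peaks (p ∷ v)) (orShifted b J)) * 2 ^ card J

weightX-∷ : ∀ s a {m} (J : Vec Bool m) → 𝟙 s * 2 ^ card (a ∷ J) ≡ 2 ^ 𝟙 a * (𝟙 s * 2 ^ card J)
weightX-∷ s false J = sym (*-identityˡ _)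
weightX-∷ s true  J = *-left-comm (𝟙 s) 2 _

weightX-flat : ∀ p b {m} x y (r : Vec ℕ m) a J → isPeak p x y ≡ false →
               weightX p b (x ∷ y ∷ r) (a ∷ J) ≡ 2 ^ 𝟙 a * weightX x a (y ∷ r) J
weightX-flat p b x y r a J notPeak rewrite notPeak = weightX-∷ (subᵇ (peaks (x ∷ y ∷ r)) (orShifted a J)) a J

weightX-peak : ∀ p b {m} x y (r : Vec ℕ m) a J → isPeak p x y ≡ true →
               weightX p b (x ∷ y ∷ r) (a ∷ J) ≡ 𝟙 (a ∨ b) * (2 ^ 𝟙 a * weightX x a (y ∷ r) J)
weightX-peak p b x y r a J peak rewrite peak =
  trans (𝟙-∧-* (a ∨ b) _ _) (cong (𝟙 (a ∨ b) *_) (weightX-∷ (subᵇ (peaks (x ∷ y ∷ r)) (orShifted a J)) a J))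

weightX-true : ∀ p {m} x y (r : Vec ℕ m) a J → weightX p true (x ∷ y ∷ r) (a ∷ J) ≡ 2 ^ 𝟙 a * weightX x a (y ∷ r) J
weightX-true p x y r a J rewrite ∨-zeroʳ a | ∨-zeroʳ (not (isPeak p x y)) = weightX-∷ (subᵇ (peaks (x ∷ y ∷ r)) (orShifted a J)) a J

weightX-below : ∀ {m x y} (r : Vec ℕ m) J b b′ → y < x → weightX x b (y ∷ r) J ≡ weightX x b′ (y ∷ r) J
weightX-below []      []      b b′ _   = refl
weightX-below {x = x} {y} (z ∷ r) (a ∷ J) b b′ y<x =
  trans (weightX-flat x b y z r a J (isPeak-below z y<x)) (sym (weightX-flat x b′ y z r a J (isPeak-below z y<x)))

mutual
  countB-exact-ascent : ∀ σ {m} x y (r : Vec ℕ m) a J → 0 < x → Admissible x (y ∷ r) → x < y →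
                        countB _⇔ᵇ_ σ (x ∷ y ∷ r) (a ∷ J) ≡ weightY x a (y ∷ r) J
  countB-exact-ascent σ x y r a J 0<x adm x<y = begin
    countB _⇔ᵇ_ σ (x ∷ y ∷ r) (a ∷ J)
      ≡⟨ countB-ascent _⇔ᵇ_ σ r a J 0<x x<y ⟩
    𝟙 (false ⇔ᵇ a) * countB _⇔ᵇ_ false (y ∷ r) J + 𝟙 (true ⇔ᵇ a) * countB _⇔ᵇ_ true (y ∷ r) J
      ≡⟨ ⇔ᵇ-select a (λ τ → countB _⇔ᵇ_ τ (y ∷ r) J) ⟩
    countB _⇔ᵇ_ a (y ∷ r) J
      ≡⟨ countB-exact-rising x a (y ∷ r) J adm x<y ⟩
    weightY x a (y ∷ r) J
      ∎

  countB-exact-descent : ∀ σ {m} x y (r : Vec ℕ m) a J → Admissible x (y ∷ r) → y < x →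
                         countB _⇔ᵇ_ σ (x ∷ y ∷ r) (a ∷ J) ≡ 𝟙 (a xor σ) * (2 * weightY x a (y ∷ r) J)
  countB-exact-descent σ x y r a J adm@(_ , 0<y , _) y<x = begin
    countB _⇔ᵇ_ σ (x ∷ y ∷ r) (a ∷ J)
      ≡⟨ countB-descent _⇔ᵇ_ σ r a J 0<y y<x ⟩
    𝟙 (not σ ⇔ᵇ a) * countB± _⇔ᵇ_ (y ∷ r) J
      ≡⟨ cong₂ _*_ (cong 𝟙 (not-⇔ᵇ σ a)) (countB±-exact-falling x a (y ∷ r) J adm y<x) ⟩
    𝟙 (a xor σ) * (2 * weightY x a (y ∷ r) J)
      ∎

  countB-exact-rising : ∀ p σ {m} (v : Vec ℕ (suc m)) J → Admissible p v → p < Vec.head v →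
                        countB _⇔ᵇ_ σ v J ≡ weightY p σ v J
  countB-exact-rising p σ (x ∷ [])    []      _               _   = refl
  countB-exact-rising p σ (x ∷ y ∷ r) (a ∷ J) (_ , 0<x , adm) p<x with <-cmp x y
  ... | tri< x<y _ _ = trans (countB-exact-ascent σ x y r a J 0<x adm x<y)
                             (sym (weightY-flat p σ x y r a J (isPeak-ascent p x<y)))
  ... | tri≈ _ x≡y _ = ⊥-elim (proj₁ adm x≡y)
  ... | tri> _ _ y<x = trans (countB-exact-descent σ x y r a J adm y<x)
                             (sym (weightY-peak p σ x y r a J (isPeak-peak p<x y<x)))

  countB±-exact-falling : ∀ p b {m} (v : Vec ℕ (suc m)) J → Admissible p v → Vec.head v < p →
                          countB± _⇔ᵇ_ v J ≡ 2 * weightY p b v J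
  countB±-exact-falling p b (x ∷ [])    []      _               _   = refl
  countB±-exact-falling p b (x ∷ y ∷ r) (a ∷ J) (_ , 0<x , adm) x<p with <-cmp x y
  ... | tri< x<y _ _ = begin
    countB± _⇔ᵇ_ (x ∷ y ∷ r) (a ∷ J)
      ≡⟨ cong₂ _+_ (countB-exact-ascent false x y r a J 0<x adm x<y) (countB-exact-ascent true x y r a J 0<x adm x<y) ⟩
    weightY x a (y ∷ r) J + weightY x a (y ∷ r) J
      ≡⟨ n+n≡2*n (weightY x a (y ∷ r) J) ⟩
    2 * weightY x a (y ∷ r) J
      ≡⟨ cong (2 *_) (sym (weightY-flat p b x y r a J (isPeak-below y x<p))) ⟩
    2 * weightY p b (x ∷ y ∷ r) (a ∷ J)
      ∎
  ... | tri≈ _ x≡y _ = ⊥-elim (proj₁ adm x≡y)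
  ... | tri> _ _ y<x = begin
    countB± _⇔ᵇ_ (x ∷ y ∷ r) (a ∷ J)
      ≡⟨ cong₂ _+_ (countB-exact-descent false x y r a J adm y<x) (countB-exact-descent true x y r a J adm y<x) ⟩
    𝟙 (a xor false) * (2 * weightY x a (y ∷ r) J) + 𝟙 (a xor true) * (2 * weightY x a (y ∷ r) J)
      ≡⟨ 𝟙-xor-pair a (2 * weightY x a (y ∷ r) J) ⟩
    2 * weightY x a (y ∷ r) J
      ≡⟨ cong (2 *_) (sym (weightY-flat p b x y r a J (isPeak-below y x<p))) ⟩
    2 * weightY p b (x ∷ y ∷ r) (a ∷ J)
      ∎

mutual
  countB-within-ascent : ∀ σ {m} x y (r : Vec ℕ m) a J → 0 < x → Admissible x (y ∷ r) → x < y →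
                         countB _⇒ᵇ_ σ (x ∷ y ∷ r) (a ∷ J) ≡ 2 ^ 𝟙 a * weightX x a (y ∷ r) J
  countB-within-ascent σ x y r false J 0<x adm x<y = begin
    countB _⇒ᵇ_ σ (x ∷ y ∷ r) (false ∷ J)
      ≡⟨ countB-ascent _⇒ᵇ_ σ r false J 0<x x<y ⟩
    1 * countB _⇒ᵇ_ false (y ∷ r) J + 0 * countB _⇒ᵇ_ true (y ∷ r) J
      ≡⟨ +-identityʳ _ ⟩
    1 * countB _⇒ᵇ_ false (y ∷ r) J
      ≡⟨ cong (1 *_) (countB-within-rising x (y ∷ r) J adm x<y) ⟩
    1 * weightX x false (y ∷ r) J
      ∎
  countB-within-ascent σ x y r true J 0<x adm x<y = begin
    countB _⇒ᵇ_ σ (x ∷ y ∷ r) (true ∷ J)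
      ≡⟨ countB-ascent _⇒ᵇ_ σ r true J 0<x x<y ⟩
    1 * countB _⇒ᵇ_ false (y ∷ r) J + 1 * countB _⇒ᵇ_ true (y ∷ r) J
      ≡⟨ cong₂ _+_ (*-identityˡ (countB _⇒ᵇ_ false (y ∷ r) J)) (*-identityˡ (countB _⇒ᵇ_ true (y ∷ r) J)) ⟩
    countB± _⇒ᵇ_ (y ∷ r) J
      ≡⟨ countB±-within x (y ∷ r) J adm ⟩
    2 * weightX x true (y ∷ r) J
      ∎

  countB±-within : ∀ p {m} (v : Vec ℕ (suc m)) J → Admissible p v → countB± _⇒ᵇ_ v J ≡ 2 * weightX p true v J
  countB±-within p (x ∷ [])    []      _               = refl
  countB±-within p (x ∷ y ∷ r) (a ∷ J) (_ , 0<x , adm@(_ , 0<y , _)) with <-cmp x y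
  ... | tri< x<y _ _ = begin
    countB± _⇒ᵇ_ (x ∷ y ∷ r) (a ∷ J)
      ≡⟨ cong₂ _+_ (countB-within-ascent false x y r a J 0<x adm x<y) (countB-within-ascent true x y r a J 0<x adm x<y) ⟩
    2 ^ 𝟙 a * weightX x a (y ∷ r) J + 2 ^ 𝟙 a * weightX x a (y ∷ r) J
      ≡⟨ n+n≡2*n (2 ^ 𝟙 a * weightX x a (y ∷ r) J) ⟩
    2 * (2 ^ 𝟙 a * weightX x a (y ∷ r) J)
      ≡⟨ cong (2 *_) (sym (weightX-true p x y r a J)) ⟩
    2 * weightX p true (x ∷ y ∷ r) (a ∷ J)
      ∎
  ... | tri≈ _ x≡y _ = ⊥-elim (proj₁ adm x≡y)
  ... | tri> _ _ y<x = begin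
    countB± _⇒ᵇ_ (x ∷ y ∷ r) (a ∷ J)
      ≡⟨ cong₂ _+_ (countB-descent _⇒ᵇ_ false r a J 0<y y<x) (countB-descent _⇒ᵇ_ true r a J 0<y y<x) ⟩
    𝟙 a * countB± _⇒ᵇ_ (y ∷ r) J + 1 * countB± _⇒ᵇ_ (y ∷ r) J
      ≡⟨ sym (*-distribʳ-+ (countB± _⇒ᵇ_ (y ∷ r) J) (𝟙 a) 1) ⟩
    (𝟙 a + 1) * countB± _⇒ᵇ_ (y ∷ r) J
      ≡⟨ cong₂ _*_ (𝟙+1 a) (countB±-within x (y ∷ r) J adm) ⟩
    2 ^ 𝟙 a * (2 * weightX x true (y ∷ r) J)
      ≡⟨ cong (λ w → 2 ^ 𝟙 a * (2 * w)) (weightX-below r J true a y<x) ⟩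
    2 ^ 𝟙 a * (2 * weightX x a (y ∷ r) J)
      ≡⟨ *-left-comm (2 ^ 𝟙 a) 2 (weightX x a (y ∷ r) J) ⟩
    2 * (2 ^ 𝟙 a * weightX x a (y ∷ r) J)
      ≡⟨ cong (2 *_) (sym (weightX-true p x y r a J)) ⟩
    2 * weightX p true (x ∷ y ∷ r) (a ∷ J)
      ∎

  countB-within-rising : ∀ p {m} (v : Vec ℕ (suc m)) J → Admissible p v → p < Vec.head v →
                         countB _⇒ᵇ_ false v J ≡ weightX p false v J
  countB-within-rising p (x ∷ [])    []      _               _   = refl
  countB-within-rising p (x ∷ y ∷ r) (a ∷ J) (_ , 0<x , adm@(_ , 0<y , _)) p<x with <-cmp x y
  ... | tri< x<y _ _ = trans (countB-within-ascent false x y r a J 0<x adm x<y)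
                             (sym (weightX-flat p false x y r a J (isPeak-ascent p x<y)))
  ... | tri≈ _ x≡y _ = ⊥-elim (proj₁ adm x≡y)
  ... | tri> _ _ y<x = begin
    countB _⇒ᵇ_ false (x ∷ y ∷ r) (a ∷ J)
      ≡⟨ countB-descent _⇒ᵇ_ false r a J 0<y y<x ⟩
    𝟙 a * countB± _⇒ᵇ_ (y ∷ r) J
      ≡⟨ cong (𝟙 a *_) (countB±-within x (y ∷ r) J adm) ⟩
    𝟙 a * (2 * weightX x true (y ∷ r) J)
      ≡⟨ peak-weight a ⟩
    𝟙 (a ∨ false) * (2 ^ 𝟙 a * weightX x a (y ∷ r) J)
      ≡⟨ sym (weightX-peak p false x y r a J (isPeak-peak p<x y<x)) ⟩
    weightX p false (x ∷ y ∷ r) (a ∷ J)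
      ∎
    where
    peak-weight : ∀ a → 𝟙 a * (2 * weightX x true (y ∷ r) J) ≡ 𝟙 (a ∨ false) * (2 ^ 𝟙 a * weightX x a (y ∷ r) J)
    peak-weight false = refl
    peak-weight true  = refl

-- Parity of the number of negative signs

evenCard : ∀ {m} → Vec Bool m → Bool
evenCard t = even (card t)

even-suc : ∀ n → even (suc n) ≡ not (even n)
even-suc zero    = refl
even-suc (suc n) = trans (sym (not-involutive (even n))) (cong not (sym (even-suc n)))

evenCard-true∷ : ∀ o {m} (s : Vec Bool m) → (o xor evenCard (true ∷ s)) ≡ (not o xor evenCard s)
evenCard-true∷ o s =
  trans (cong (o xor_) (even-suc (card s))) (trans (sym (not-distribʳ-xor o _)) (not-distribˡ-xor o _))

∑ₚ : Bool → (m : ℕ) → (Vec Bool m → ℕ) → ℕ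
∑ₚ odd m f = ∑ m (λ t → 𝟙 (odd xor evenCard t) * f t)

∑ₚ-cong : ∀ o m {f g : Vec Bool m → ℕ} → (∀ t → f t ≡ g t) → ∑ₚ o m f ≡ ∑ₚ o m g
∑ₚ-cong o m f≗g = ∑-cong m (λ t → cong (𝟙 (o xor evenCard t) *_) (f≗g t))

∑ₚ-distribˡ-* : ∀ o m c (f : Vec Bool m → ℕ) → ∑ₚ o m (λ t → c * f t) ≡ c * ∑ₚ o m f
∑ₚ-distribˡ-* o m c f = trans (∑-cong m (λ t → *-left-comm (𝟙 (o xor evenCard t)) c (f t))) (∑-distribˡ-* m c _)

∑ₚ-∷ : ∀ o m (f : Vec Bool (suc m) → ℕ) → ∑ₚ o (suc m) f ≡ ∑ₚ o m (f ∘ (false ∷_)) + ∑ₚ (not o) m (f ∘ (true ∷_))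
∑ₚ-∷ o m f =
  trans (∑-cong m (λ s → cong (λ q → 𝟙 (o xor evenCard s) * f (false ∷ s) + 𝟙 q * f (true ∷ s)) (evenCard-true∷ o s)))
        (∑-distrib-+ m _ _)

∑ₚ-pair : ∀ o m (f : Vec Bool m → ℕ) → ∑ₚ o m f + ∑ₚ (not o) m f ≡ ∑ m f
∑ₚ-pair o m f = trans (sym (∑-distrib-+ m _ _)) (∑-cong m pair)
  where
  pair : ∀ t → 𝟙 (o xor evenCard t) * f t + 𝟙 (not o xor evenCard t) * f t ≡ f t
  pair t = trans (cong (λ q → 𝟙 (o xor evenCard t) * f t + 𝟙 q * f t) (sym (not-distribˡ-xor o (evenCard t))))
                 (𝟙-not-pair (o xor evenCard t) (f t))

∑ₚ-free : ∀ o m (f : Vec Bool (suc m) → ℕ) → (∀ s → f (false ∷ s) ≡ f (true ∷ s)) → ∑ₚ o (suc m) f ≡ ∑ m (f ∘ (false ∷_))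
∑ₚ-free o m f free = begin
  ∑ₚ o (suc m) f                                            ≡⟨ ∑ₚ-∷ o m f ⟩
  ∑ₚ o m (f ∘ (false ∷_)) + ∑ₚ (not o) m (f ∘ (true ∷_))   ≡⟨ cong (∑ₚ o m (f ∘ (false ∷_)) +_) (∑ₚ-cong (not o) m (sym ∘ free)) ⟩
  ∑ₚ o m (f ∘ (false ∷_)) + ∑ₚ (not o) m (f ∘ (false ∷_))  ≡⟨ ∑ₚ-pair o m _ ⟩
  ∑ m (f ∘ (false ∷_))                                      ∎

∑ₚ-first : ∀ o m (f : Vec Bool (suc m) → ℕ) (q : Bool → Bool) (g : Vec Bool m → ℕ) →
           (∀ σ s → f (σ ∷ s) ≡ 𝟙 (q σ) * g s) → ∑ₚ o (suc m) f ≡ 𝟙 (q false) * ∑ₚ o m g + 𝟙 (q true) * ∑ₚ (not o) m g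
∑ₚ-first o m f q g f≡ =
  trans (∑ₚ-∷ o m f)
        (cong₂ _+_ (trans (∑ₚ-cong o m (f≡ false)) (∑ₚ-distribˡ-* o m (𝟙 (q false)) g))
                   (trans (∑ₚ-cong (not o) m (f≡ true)) (∑ₚ-distribˡ-* (not o) m (𝟙 (q true)) g)))

countParity : (Bool → Bool → Bool) → Bool → ∀ {m} → Vec ℕ (suc m) → Vec Bool m → ℕ
countParity c odd {m} v J = ∑ₚ odd (suc m) (matches c v J)

countParity-pair : ∀ c o {m} (v : Vec ℕ (suc m)) J → countParity c o v J + countParity c (not o) v J ≡ countB± c v J
countParity-pair c o {m} v J =
  trans (∑ₚ-pair o (suc m) (matches c v J)) (∑-distrib-+ m (matches c v J ∘ (false ∷_)) (matches c v J ∘ (true ∷_)))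

countParity-ascent : ∀ c o {m x y} (r : Vec ℕ m) a J → 0 < x → x < y →
                     countParity c o (x ∷ y ∷ r) (a ∷ J) ≡ countB c false (x ∷ y ∷ r) (a ∷ J)
countParity-ascent c o {m} {x} {y} r a J 0<x x<y = ∑ₚ-free o (suc m) (matches c (x ∷ y ∷ r) (a ∷ J)) free
  where
  free : ∀ s → matches c (x ∷ y ∷ r) (a ∷ J) (false ∷ s) ≡ matches c (x ∷ y ∷ r) (a ∷ J) (true ∷ s)
  free (τ ∷ t) = cong (λ d → 𝟙 (c d a ∧ pointwise c (descents (signWith (τ ∷ t) (y ∷ r))) J))
                      (trans (signed-ascent false τ 0<x x<y) (sym (signed-ascent true τ 0<x x<y)))

countParity-descent : ∀ c o {m x y} (r : Vec ℕ m) a J → 0 < y → y < x →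
  countParity c o (x ∷ y ∷ r) (a ∷ J) ≡ 𝟙 (c true a) * countParity c o (y ∷ r) J + 𝟙 (c false a) * countParity c (not o) (y ∷ r) J
countParity-descent c o {m} {x} {y} r a J 0<y y<x =
  ∑ₚ-first o (suc m) (matches c (x ∷ y ∷ r) (a ∷ J)) (λ σ → c (not σ) a) (matches c (y ∷ r) J) split
  where
  split : ∀ σ s → matches c (x ∷ y ∷ r) (a ∷ J) (σ ∷ s) ≡ 𝟙 (c (not σ) a) * matches c (y ∷ r) J s
  split σ (τ ∷ t) = trans (cong (λ d → 𝟙 (c d a ∧ pointwise c (descents (signWith (τ ∷ t) (y ∷ r))) J))
                                (signed-descent σ τ 0<y y<x))
                          (𝟙-∧ (c (not σ) a) (pointwise c (descents (signWith (τ ∷ t) (y ∷ r))) J))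

countParity-balanced : ∀ c p {m} (v : Vec ℕ (suc m)) J → Admissible p v → ∀ o →
                       countParity c o v J ≡ countParity c (not o) v J
countParity-balanced c p (x ∷ [])    []      _ false = refl
countParity-balanced c p (x ∷ [])    []      _ true  = refl
countParity-balanced c p (x ∷ y ∷ r) (a ∷ J) (_ , 0<x , adm@(_ , 0<y , _)) o with <-cmp x y
... | tri< x<y _ _ = trans (countParity-ascent c o r a J 0<x x<y) (sym (countParity-ascent c (not o) r a J 0<x x<y))
... | tri≈ _ x≡y _ = ⊥-elim (proj₁ adm x≡y)
... | tri> _ _ y<x = begin
  countParity c o (x ∷ y ∷ r) (a ∷ J)
    ≡⟨ countParity-descent c o r a J 0<y y<x ⟩
  𝟙 (c true a) * countParity c o (y ∷ r) J + 𝟙 (c false a) * countParity c (not o) (y ∷ r) J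
    ≡⟨ cong₂ (λ m n → 𝟙 (c true a) * m + 𝟙 (c false a) * n)
             (countParity-balanced c x (y ∷ r) J adm o) (countParity-balanced c x (y ∷ r) J adm (not o)) ⟩
  𝟙 (c true a) * countParity c (not o) (y ∷ r) J + 𝟙 (c false a) * countParity c (not (not o)) (y ∷ r) J
    ≡⟨ sym (countParity-descent c (not o) r a J 0<y y<x) ⟩
  countParity c (not o) (x ∷ y ∷ r) (a ∷ J)
    ∎

countParity-half : ∀ c p o {m} (v : Vec ℕ (suc m)) J R → Admissible p v → countB± c v J ≡ 2 * R →
                   countParity c o v J ≡ R
countParity-half c p o v J R adm total = *-cancelˡ-≡ (countParity c o v J) R 2 (begin
  2 * countParity c o v J                             ≡⟨ sym (n+n≡2*n (countParity c o v J)) ⟩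
  countParity c o v J + countParity c o v J           ≡⟨ cong (countParity c o v J +_) (countParity-balanced c p v J adm o) ⟩
  countParity c o v J + countParity c (not o) v J     ≡⟨ countParity-pair c o v J ⟩
  countB± c v J                                       ≡⟨ total ⟩
  2 * R                                               ∎)

-- Type D

-- b and a prescribe the descents 1′ and 1, J the descents 2, …, n−1.
matchesD : (Bool → Bool → Bool) → Bool → Bool → ∀ {k} → Vec Bool k → Vec ℕ (suc (suc k)) → Vec Bool (suc (suc k)) → ℕ
matchesD c b a J u s = 𝟙 (c (descent′ (signWith s u)) b ∧ pointwise c (descents (signWith s u)) (a ∷ J))

countD : (Bool → Bool → Bool) → Bool → Bool → ∀ {k} → Vec Bool k → Vec ℕ (suc (suc k)) → ℕ
countD c b a {k} J u = ∑ₚ false (suc (suc k)) (matchesD c b a J u)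

countD-ascent : ∀ c b a {k} (J : Vec Bool k) {x y} (r : Vec ℕ k) → 0 < x → x < y →
  countD c b a J (x ∷ y ∷ r) ≡ 𝟙 (c false b ∧ c false a) * countB c false (y ∷ r) J
                             + 𝟙 (c true b ∧ c true a) * countB c true (y ∷ r) J
countD-ascent c b a {k} J {x} {y} r 0<x x<y = begin
  countD c b a J (x ∷ y ∷ r)
    ≡⟨ ∑ₚ-free false (suc k) (matchesD c b a J (x ∷ y ∷ r)) (λ { (τ ∷ t) → trans (summand false τ t) (sym (summand true τ t)) }) ⟩
  ∑ k (λ t → matchesD c b a J (x ∷ y ∷ r) (false ∷ false ∷ t) + matchesD c b a J (x ∷ y ∷ r) (false ∷ true ∷ t))
    ≡⟨ ∑-cong k (λ t → cong₂ _+_ (summand false false t) (summand false true t)) ⟩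
  ∑ k (λ t → 𝟙 (c false b ∧ c false a) * R false t + 𝟙 (c true b ∧ c true a) * R true t)
    ≡⟨ ∑-distrib-+ k _ _ ⟩
  ∑ k (λ t → 𝟙 (c false b ∧ c false a) * R false t) + ∑ k (λ t → 𝟙 (c true b ∧ c true a) * R true t)
    ≡⟨ cong₂ _+_ (∑-distribˡ-* k (𝟙 (c false b ∧ c false a)) (R false)) (∑-distribˡ-* k (𝟙 (c true b ∧ c true a)) (R true)) ⟩
  𝟙 (c false b ∧ c false a) * countB c false (y ∷ r) J + 𝟙 (c true b ∧ c true a) * countB c true (y ∷ r) J
    ∎
  where
  R : Bool → Vec Bool k → ℕ
  R τ t = matches c (y ∷ r) J (τ ∷ t)
  summand : ∀ σ τ t → matchesD c b a J (x ∷ y ∷ r) (σ ∷ τ ∷ t) ≡ 𝟙 (c τ b ∧ c τ a) * R τ t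
  summand σ τ t = begin
    𝟙 (c (signed τ y <ℤ - signed σ x) b ∧ (c (signed τ y <ℤ signed σ x) a ∧ Q))
      ≡⟨ cong₂ (λ d₀ d₁ → 𝟙 (c d₀ b ∧ (c d₁ a ∧ Q)))
               (trans (cong (signed τ y <ℤ_) (negate-signed σ x)) (signed-ascent (not σ) τ 0<x x<y))
               (signed-ascent σ τ 0<x x<y) ⟩
    𝟙 (c τ b ∧ (c τ a ∧ Q))  ≡⟨ cong 𝟙 (sym (∧-assoc (c τ b) (c τ a) Q)) ⟩
    𝟙 ((c τ b ∧ c τ a) ∧ Q)  ≡⟨ 𝟙-∧ (c τ b ∧ c τ a) Q ⟩
    𝟙 (c τ b ∧ c τ a) * R τ t ∎
    where Q = pointwise c (descents (signWith (τ ∷ t) (y ∷ r))) J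

countD-descent : ∀ c b a {k} (J : Vec Bool k) {x y} (r : Vec ℕ k) → 0 < y → y < x →
  countD c b a J (x ∷ y ∷ r) ≡ 𝟙 (c false b ∧ c true a) * countParity c false (y ∷ r) J
                             + 𝟙 (c true b ∧ c false a) * countParity c true (y ∷ r) J
countD-descent c b a {k} J {x} {y} r 0<y y<x =
  ∑ₚ-first false (suc k) (matchesD c b a J (x ∷ y ∷ r)) (λ σ → c σ b ∧ c (not σ) a) (matches c (y ∷ r) J) summand
  where
  summand : ∀ σ s → matchesD c b a J (x ∷ y ∷ r) (σ ∷ s) ≡ 𝟙 (c σ b ∧ c (not σ) a) * matches c (y ∷ r) J s
  summand σ (τ ∷ t) = begin
    𝟙 (c (signed τ y <ℤ - signed σ x) b ∧ (c (signed τ y <ℤ signed σ x) a ∧ Q))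
      ≡⟨ cong₂ (λ d₀ d₁ → 𝟙 (c d₀ b ∧ (c d₁ a ∧ Q)))
               (trans (cong (signed τ y <ℤ_) (negate-signed σ x)) (trans (signed-descent (not σ) τ 0<y y<x) (not-involutive σ)))
               (signed-descent σ τ 0<y y<x) ⟩
    𝟙 (c σ b ∧ (c (not σ) a ∧ Q))  ≡⟨ cong 𝟙 (sym (∧-assoc (c σ b) (c (not σ) a) Q)) ⟩
    𝟙 ((c σ b ∧ c (not σ) a) ∧ Q)  ≡⟨ 𝟙-∧ (c σ b ∧ c (not σ) a) Q ⟩
    𝟙 (c σ b ∧ c (not σ) a) * 𝟙 Q  ∎
    where Q = pointwise c (descents (signWith (τ ∷ t) (y ∷ r))) J

countD-exact-diag : ∀ a {k} (J : Vec Bool k) (u : Vec ℕ (suc (suc k))) → Admissible 0 u →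
                    countD _⇔ᵇ_ a a J u ≡ weightY 0 a u (a ∷ J)
countD-exact-diag a J (x ∷ y ∷ r) (_ , 0<x , adm@(_ , 0<y , _)) with <-cmp x y
... | tri< x<y _ _ = begin
  countD _⇔ᵇ_ a a J (x ∷ y ∷ r)
    ≡⟨ countD-ascent _⇔ᵇ_ a a J r 0<x x<y ⟩
  𝟙 ((false ⇔ᵇ a) ∧ (false ⇔ᵇ a)) * B false + 𝟙 ((true ⇔ᵇ a) ∧ (true ⇔ᵇ a)) * B true
    ≡⟨ cong₂ (λ p q → 𝟙 p * B false + 𝟙 q * B true) (∧-idem (false ⇔ᵇ a)) (∧-idem (true ⇔ᵇ a)) ⟩
  𝟙 (false ⇔ᵇ a) * B false + 𝟙 (true ⇔ᵇ a) * B true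
    ≡⟨ ⇔ᵇ-select a B ⟩
  B a
    ≡⟨ countB-exact-rising x a (y ∷ r) J adm x<y ⟩
  weightY x a (y ∷ r) J
    ≡⟨ sym (weightY-flat 0 a x y r a J (isPeak-ascent 0 x<y)) ⟩
  weightY 0 a (x ∷ y ∷ r) (a ∷ J)
    ∎
  where
  B : Bool → ℕ
  B τ = countB _⇔ᵇ_ τ (y ∷ r) J
... | tri≈ _ x≡y _ = ⊥-elim (proj₁ adm x≡y)
... | tri> _ _ y<x = begin
  countD _⇔ᵇ_ a a J (x ∷ y ∷ r)
    ≡⟨ countD-descent _⇔ᵇ_ a a J r 0<y y<x ⟩
  𝟙 ((false ⇔ᵇ a) ∧ (true ⇔ᵇ a)) * countParity _⇔ᵇ_ false (y ∷ r) J + 𝟙 ((true ⇔ᵇ a) ∧ (false ⇔ᵇ a)) * countParity _⇔ᵇ_ true (y ∷ r) J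
    ≡⟨ clash a _ _ ⟩
  𝟙 (a xor a) * (2 * weightY x a (y ∷ r) J)
    ≡⟨ sym (weightY-peak 0 a x y r a J (isPeak-peak 0<x y<x)) ⟩
  weightY 0 a (x ∷ y ∷ r) (a ∷ J)
    ∎
  where
  clash : ∀ a m n → 𝟙 ((false ⇔ᵇ a) ∧ (true ⇔ᵇ a)) * m + 𝟙 ((true ⇔ᵇ a) ∧ (false ⇔ᵇ a)) * n ≡ 𝟙 (a xor a) * (2 * weightY x a (y ∷ r) J)
  clash false m n = refl
  clash true  m n = refl

countD-exact-offdiag : ∀ b {k} (J : Vec Bool k) x y (r : Vec ℕ k) → Admissible 0 (x ∷ y ∷ r) →
                       countD _⇔ᵇ_ b (not b) J (x ∷ y ∷ r) ≡ 𝟙 (isPeak 0 x y) * weightY x false (y ∷ r) J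
countD-exact-offdiag b J x y r (_ , 0<x , adm@(_ , 0<y , _)) with <-cmp x y
... | tri< x<y _ _ = begin
  countD _⇔ᵇ_ b (not b) J (x ∷ y ∷ r)
    ≡⟨ countD-ascent _⇔ᵇ_ b (not b) J r 0<x x<y ⟩
  𝟙 ((false ⇔ᵇ b) ∧ (false ⇔ᵇ not b)) * countB _⇔ᵇ_ false (y ∷ r) J + 𝟙 ((true ⇔ᵇ b) ∧ (true ⇔ᵇ not b)) * countB _⇔ᵇ_ true (y ∷ r) J
    ≡⟨ clash b _ _ ⟩
  0
    ≡⟨ cong (λ h → 𝟙 h * weightY x false (y ∷ r) J) (sym (isPeak-ascent 0 x<y)) ⟩
  𝟙 (isPeak 0 x y) * weightY x false (y ∷ r) J
    ∎
  where
  clash : ∀ b m n → 𝟙 ((false ⇔ᵇ b) ∧ (false ⇔ᵇ not b)) * m + 𝟙 ((true ⇔ᵇ b) ∧ (true ⇔ᵇ not b)) * n ≡ 0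
  clash false m n = refl
  clash true  m n = refl
... | tri≈ _ x≡y _ = ⊥-elim (proj₁ adm x≡y)
... | tri> _ _ y<x = begin
  countD _⇔ᵇ_ b (not b) J (x ∷ y ∷ r)
    ≡⟨ countD-descent _⇔ᵇ_ b (not b) J r 0<y y<x ⟩
  𝟙 ((false ⇔ᵇ b) ∧ (true ⇔ᵇ not b)) * countParity _⇔ᵇ_ false (y ∷ r) J + 𝟙 ((true ⇔ᵇ b) ∧ (false ⇔ᵇ not b)) * countParity _⇔ᵇ_ true (y ∷ r) J
    ≡⟨ cong₂ (λ m n → 𝟙 ((false ⇔ᵇ b) ∧ (true ⇔ᵇ not b)) * m + 𝟙 ((true ⇔ᵇ b) ∧ (false ⇔ᵇ not b)) * n) (half false) (half true) ⟩
  𝟙 ((false ⇔ᵇ b) ∧ (true ⇔ᵇ not b)) * W + 𝟙 ((true ⇔ᵇ b) ∧ (false ⇔ᵇ not b)) * W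
    ≡⟨ select b ⟩
  W
    ≡⟨ sym (*-identityˡ W) ⟩
  1 * W
    ≡⟨ cong (λ h → 𝟙 h * W) (sym (isPeak-peak 0<x y<x)) ⟩
  𝟙 (isPeak 0 x y) * W
    ∎
  where
  W = weightY x false (y ∷ r) J
  half : ∀ o → countParity _⇔ᵇ_ o (y ∷ r) J ≡ W
  half o = countParity-half _⇔ᵇ_ x o (y ∷ r) J W adm (countB±-exact-falling x false (y ∷ r) J adm y<x)
  select : ∀ b → 𝟙 ((false ⇔ᵇ b) ∧ (true ⇔ᵇ not b)) * W + 𝟙 ((true ⇔ᵇ b) ∧ (false ⇔ᵇ not b)) * W ≡ W
  select false = trans (+-identityʳ _) (+-identityʳ W)
  select true  = +-identityʳ W

countD-within-diag : ∀ a {k} (J : Vec Bool k) (u : Vec ℕ (suc (suc k))) → Admissible 0 u →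
                     countD _⇒ᵇ_ a a J u ≡ weightX 0 a u (a ∷ J)
countD-within-diag a J (x ∷ y ∷ r) (_ , 0<x , adm@(_ , 0<y , _)) with <-cmp x y
... | tri< x<y _ _ = begin
  countD _⇒ᵇ_ a a J (x ∷ y ∷ r)
    ≡⟨ countD-ascent _⇒ᵇ_ a a J r 0<x x<y ⟩
  1 * countB _⇒ᵇ_ false (y ∷ r) J + 𝟙 (a ∧ a) * countB _⇒ᵇ_ true (y ∷ r) J
    ≡⟨ cong (λ q → 1 * countB _⇒ᵇ_ false (y ∷ r) J + 𝟙 q * countB _⇒ᵇ_ true (y ∷ r) J) (∧-idem a) ⟩
  1 * countB _⇒ᵇ_ false (y ∷ r) J + 𝟙 a * countB _⇒ᵇ_ true (y ∷ r) J
    ≡⟨ sym (countB-ascent _⇒ᵇ_ false r a J 0<x x<y) ⟩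
  countB _⇒ᵇ_ false (x ∷ y ∷ r) (a ∷ J)
    ≡⟨ countB-within-ascent false x y r a J 0<x adm x<y ⟩
  2 ^ 𝟙 a * weightX x a (y ∷ r) J
    ≡⟨ sym (weightX-flat 0 a x y r a J (isPeak-ascent 0 x<y)) ⟩
  weightX 0 a (x ∷ y ∷ r) (a ∷ J)
    ∎
... | tri≈ _ x≡y _ = ⊥-elim (proj₁ adm x≡y)
... | tri> _ _ y<x = begin
  countD _⇒ᵇ_ a a J (x ∷ y ∷ r)
    ≡⟨ countD-descent _⇒ᵇ_ a a J r 0<y y<x ⟩
  𝟙 a * Pₒ false + 𝟙 (a ∧ true) * Pₒ true
    ≡⟨ cong (λ q → 𝟙 a * Pₒ false + 𝟙 q * Pₒ true) (∧-identityʳ a) ⟩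
  𝟙 a * Pₒ false + 𝟙 a * Pₒ true
    ≡⟨ sym (*-distribˡ-+ (𝟙 a) (Pₒ false) (Pₒ true)) ⟩
  𝟙 a * (Pₒ false + Pₒ true)
    ≡⟨ cong (𝟙 a *_) (trans (countParity-pair _⇒ᵇ_ false (y ∷ r) J) (countB±-within x (y ∷ r) J adm)) ⟩
  𝟙 a * (2 * weightX x true (y ∷ r) J)
    ≡⟨ peak-weight a ⟩
  𝟙 (a ∨ a) * (2 ^ 𝟙 a * weightX x a (y ∷ r) J)
    ≡⟨ sym (weightX-peak 0 a x y r a J (isPeak-peak 0<x y<x)) ⟩
  weightX 0 a (x ∷ y ∷ r) (a ∷ J)
    ∎
  where
  Pₒ : Bool → ℕ
  Pₒ o = countParity _⇒ᵇ_ o (y ∷ r) J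
  peak-weight : ∀ a → 𝟙 a * (2 * weightX x true (y ∷ r) J) ≡ 𝟙 (a ∨ a) * (2 ^ 𝟙 a * weightX x a (y ∷ r) J)
  peak-weight false = refl
  peak-weight true  = refl

countD-within-offdiag : ∀ b {k} (J : Vec Bool k) x y (r : Vec ℕ k) → Admissible 0 (x ∷ y ∷ r) →
                        countD _⇒ᵇ_ b (not b) J (x ∷ y ∷ r) ≡ weightX x false (y ∷ r) J
countD-within-offdiag b J x y r (_ , 0<x , adm@(_ , 0<y , _)) with <-cmp x y
... | tri< x<y _ _ = begin
  countD _⇒ᵇ_ b (not b) J (x ∷ y ∷ r)
    ≡⟨ countD-ascent _⇒ᵇ_ b (not b) J r 0<x x<y ⟩
  1 * countB _⇒ᵇ_ false (y ∷ r) J + 𝟙 (b ∧ not b) * countB _⇒ᵇ_ true (y ∷ r) J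
    ≡⟨ cong (λ q → 1 * countB _⇒ᵇ_ false (y ∷ r) J + 𝟙 q * countB _⇒ᵇ_ true (y ∷ r) J) (∧-inverseʳ b) ⟩
  1 * countB _⇒ᵇ_ false (y ∷ r) J + 0
    ≡⟨ trans (+-identityʳ _) (*-identityˡ _) ⟩
  countB _⇒ᵇ_ false (y ∷ r) J
    ≡⟨ countB-within-rising x (y ∷ r) J adm x<y ⟩
  weightX x false (y ∷ r) J
    ∎
... | tri≈ _ x≡y _ = ⊥-elim (proj₁ adm x≡y)
... | tri> _ _ y<x = begin
  countD _⇒ᵇ_ b (not b) J (x ∷ y ∷ r)
    ≡⟨ countD-descent _⇒ᵇ_ b (not b) J r 0<y y<x ⟩
  𝟙 (not b) * countParity _⇒ᵇ_ false (y ∷ r) J + 𝟙 (b ∧ true) * countParity _⇒ᵇ_ true (y ∷ r) J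
    ≡⟨ cong₂ (λ m n → 𝟙 (not b) * m + 𝟙 (b ∧ true) * n) (half false) (half true) ⟩
  𝟙 (not b) * W + 𝟙 (b ∧ true) * W
    ≡⟨ select b ⟩
  W
    ∎
  where
  W = weightX x false (y ∷ r) J
  half : ∀ o → countParity _⇒ᵇ_ o (y ∷ r) J ≡ W
  half o = countParity-half _⇒ᵇ_ x o (y ∷ r) J W adm
             (trans (countB±-within x (y ∷ r) J adm) (cong (2 *_) (weightX-below r J true false y<x)))
  select : ∀ b → 𝟙 (not b) * W + 𝟙 (b ∧ true) * W ≡ W
  select false = trans (+-identityʳ _) (+-identityʳ W)
  select true  = +-identityʳ W

signCount : ∀ k → (DSet k → DSet k → Bool) → DSet k → Vec ℕ (suc (suc k)) → ℕ
signCount k R I u = ∑ (suc (suc k)) (λ s → 𝟙 (even (negCount (signWith s u)) ∧ R (Des (signWith s u)) I))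

signCount≡countD : ∀ k (R : DSet k → DSet k → Bool) c b a (J : Vec Bool k) u → Admissible 0 u →
                   (∀ d D → R (d , D) (b , a ∷ J) ≡ (c d b ∧ pointwise c D (a ∷ J))) →
                   signCount k R (b , a ∷ J) u ≡ countD c b a J u
signCount≡countD k R c b a J u adm R≡ = ∑-cong (suc (suc k)) summand
  where
  summand : ∀ s → 𝟙 (even (negCount (signWith s u)) ∧ R (Des (signWith s u)) (b , a ∷ J))
                ≡ 𝟙 (false xor evenCard s) * matchesD c b a J u s
  summand s = begin
    𝟙 (even (negCount w) ∧ R (Des w) (b , a ∷ J))
      ≡⟨ cong₂ (λ n D → 𝟙 (even n ∧ R D (b , a ∷ J))) (negCount-signWith s u adm) (Des≡ w) ⟩
    𝟙 (evenCard s ∧ R (descent′ w , descents w) (b , a ∷ J))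
      ≡⟨ cong (λ q → 𝟙 (evenCard s ∧ q)) (R≡ (descent′ w) (descents w)) ⟩
    𝟙 (evenCard s ∧ (c (descent′ w) b ∧ pointwise c (descents w) (a ∷ J)))
      ≡⟨ 𝟙-∧ (evenCard s) _ ⟩
    𝟙 (evenCard s) * matchesD c b a J u s
      ∎
    where w = signWith s u

ψ-Y : ∀ k I → ψ (Y k I) ≡ weighted (signCount k eqD I) (Sn (suc (suc k)))
ψ-Y k I = trans (cong ψ (filterᵇ-filterᵇ (λ w → even (negCount w)) (λ w → eqD (Des w) I) (Bn (suc (suc k)))))
                (ψ-filterᵇ-signings (λ w → even (negCount w) ∧ eqD (Des w) I) (Sn (suc (suc k))))

signCount-⊆ : ∀ k I u → sum (map (λ I′ → signCount k eqD I′ u) (filterᵇ (λ I′ → subD I′ I) (allDSets k))) ≡ signCount k subD I u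
signCount-⊆ k I u = trans (sum-∑-comm (suc (suc k)) Is summandY) (∑-cong (suc (suc k)) summand)
  where
  Is = filterᵇ (λ I′ → subD I′ I) (allDSets k)
  summandY : DSet k → Vec Bool (suc (suc k)) → ℕ
  summandY I′ s = 𝟙 (even (negCount (signWith s u)) ∧ eqD (Des (signWith s u)) I′)
  summand : ∀ s → sum (map (λ I′ → summandY I′ s) Is) ≡ 𝟙 (even (negCount (signWith s u)) ∧ subD (Des (signWith s u)) I)
  summand s = begin
    sum (map (λ I′ → 𝟙 (E ∧ eqD D I′)) Is)        ≡⟨ cong sum (List.map-cong (λ I′ → 𝟙-∧ E (eqD D I′)) Is) ⟩
    sum (map (λ I′ → 𝟙 E * 𝟙 (eqD D I′)) Is)      ≡⟨ sum-filterᵇ-δ-DSet k (λ I′ → subD I′ I) (λ _ → 𝟙 E) D ⟩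
    𝟙 (subD D I) * 𝟙 E                            ≡⟨ *-comm (𝟙 (subD D I)) (𝟙 E) ⟩
    𝟙 E * 𝟙 (subD D I)                            ≡⟨ sym (𝟙-∧ E (subD D I)) ⟩
    𝟙 (E ∧ subD D I)                              ∎
    where
    E = even (negCount (signWith s u))
    D = Des (signWith s u)

ψ-X : ∀ k I → ψ (X k I) ↭ weighted (signCount k subD I) (Sn (suc (suc k)))
ψ-X k I = ↭-trans (↭-reflexive (trans (List.map-concatMap (Vec.map ∣_∣) (Y k) Is) (List.concatMap-cong (ψ-Y k) Is)))
          (↭-trans (concatMap-weighted (λ I′ → weighted (signCount k eqD I′) Sn₂) (signCount k eqD) Sn₂ Is (λ _ → ↭-refl))
                   (↭-reflexive (weighted-cong (All.universal (signCount-⊆ k I) Sn₂))))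
  where
  Is = filterᵇ (λ I′ → subD I′ I) (allDSets k)
  Sn₂ = Sn (suc (suc k))

ψY≡countD : ∀ k b a (J : Vec Bool k) → ψ (Y k (b , a ∷ J)) ≡ weighted (countD _⇔ᵇ_ b a J) (Sn (suc (suc k)))
ψY≡countD k b a J =
  trans (ψ-Y k (b , a ∷ J))
        (weighted-cong (All.map (λ {u} adm → signCount≡countD k eqD _⇔ᵇ_ b a J u adm eqD-pointwise) (Sn-admissible _)))
  where
  eqD-pointwise : ∀ d D → eqD (d , D) (b , a ∷ J) ≡ ((d ⇔ᵇ b) ∧ pointwise _⇔ᵇ_ D (a ∷ J))
  eqD-pointwise d D = cong ((d ⇔ᵇ b) ∧_) (eqBs≡pointwise D (a ∷ J))

ψX↭countD : ∀ k b a (J : Vec Bool k) → ψ (X k (b , a ∷ J)) ↭ weighted (countD _⇒ᵇ_ b a J) (Sn (suc (suc k)))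
ψX↭countD k b a J =
  ↭-trans (ψ-X k (b , a ∷ J))
          (↭-reflexive (weighted-cong (All.map (λ {u} adm → signCount≡countD k subD _⇒ᵇ_ b a J u adm subD-pointwise) (Sn-admissible _))))
  where
  subD-pointwise : ∀ d D → subD (d , D) (b , a ∷ J) ≡ ((d ⇒ᵇ b) ∧ pointwise _⇒ᵇ_ D (a ∷ J))
  subD-pointwise d D = cong ((d ⇒ᵇ b) ∧_) (subᵇ≡pointwise D (a ∷ J))

P≡weighted : ∀ k F → P k F ≡ weighted (λ u → 𝟙 (eqBs (Peak u) F)) (Sn (suc (suc k)))
P≡weighted k F = filterᵇ-weighted (λ u → eqBs (Peak u) F) (Sn (suc (suc k)))

sumA↭weighted : ∀ k S → sumA k S ↭ weighted (λ u → 𝟙 (subᵇ (peaks (0 ∷ u)) S) * 2 ^ card (peaks (0 ∷ u))) (Sn (suc (suc k)))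
sumA↭weighted k S =
  ↭-trans (concatMap-weighted (λ F → (2 ^ card F) · P k F) (λ F u → 2 ^ card F * 𝟙 (eqBs (Peak u) F)) Sn₂ Fs
                              (λ F → ↭-trans (·-↭ (2 ^ card F) (↭-reflexive (P≡weighted k F))) (·-weighted (2 ^ card F) _ Sn₂)))
          (↭-reflexive (weighted-cong (All.universal coefficient Sn₂)))
  where
  Sn₂ = Sn (suc (suc k))
  Fs = filterᵇ (λ F → noConsec F ∧ subᵇ F S) (allSubsets (suc k))
  coefficient : ∀ u → sum (map (λ F → 2 ^ card F * 𝟙 (eqBs (Peak u) F)) Fs) ≡ 𝟙 (subᵇ (peaks (0 ∷ u)) S) * 2 ^ card (peaks (0 ∷ u))
  coefficient u rewrite sum-filterᵇ-δ (suc k) (λ F → noConsec F ∧ subᵇ F S) (λ F → 2 ^ card F) (Peak u)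
                      | Peak≡peaks u | noConsec-peaks (0 ∷ u) = refl

·sumC↭weighted : ∀ k c S → c · sumC k S ↭ weighted (λ u → c * 𝟙 (subᵇ (peaks (0 ∷ u)) S)) (Sn (suc (suc k)))
·sumC↭weighted k c S =
  ↭-trans (·-↭ c (concatMap-weighted (P k) (λ F u → 1 * 𝟙 (eqBs (Peak u) F)) Sn₂ Fs
                                     (λ F → ↭-reflexive (trans (P≡weighted k F) (weighted-cong (All.universal (λ u → sym (*-identityˡ _)) Sn₂))))))
          (↭-trans (·-weighted c _ Sn₂) (↭-reflexive (weighted-cong (All.universal (λ u → cong (c *_) (coefficient u)) Sn₂))))
  where
  Sn₂ = Sn (suc (suc k))
  Fs = filterᵇ (λ F → noConsec F ∧ subᵇ F S) (allSubsets (suc k))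
  coefficient : ∀ u → sum (map (λ F → 1 * 𝟙 (eqBs (Peak u) F)) Fs) ≡ 𝟙 (subᵇ (peaks (0 ∷ u)) S)
  coefficient u rewrite sum-filterᵇ-δ (suc k) (λ F → noConsec F ∧ subᵇ F S) (λ _ → 1) (Peak u)
                      | Peak≡peaks u | noConsec-peaks (0 ∷ u) = *-identityʳ _

sumB-coefficient : ∀ k S (Q : Vec Bool (suc k)) → noConsec Q ≡ true →
  sum (map (λ F → 2 ^ card F * 𝟙 (eqBs Q (one ∪ F))) (filterᵇ (λ F → noConsec (one ∪ F) ∧ subᵇ F (false ∷ S)) (allSubsets (suc k))))
  ≡ 𝟙 (Vec.head Q) * (𝟙 (subᵇ (Vec.tail Q) S) * 2 ^ card (Vec.tail Q))
sumB-coefficient k S (h ∷ Q) noConsec-hQ = begin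
  sum (map W (filterᵇ q (allSubsets (suc k))))
    ≡⟨ sum-map-filterᵇ q W (allSubsets (suc k)) ⟩
  sum (map (λ F → 𝟙 (q F) * W F) (allSubsets (suc k)))
    ≡⟨ sum-allSubsets (suc k) (λ F → 𝟙 (q F) * W F) ⟩
  ∑ k (λ t → 𝟙 (q (false ∷ t)) * W (false ∷ t) + 𝟙 (q (true ∷ t)) * W (true ∷ t))
    ≡⟨ ∑-cong k summand ⟩
  ∑ k (λ t → 𝟙 h * (𝟙 (noConsec (true ∷ t) ∧ subᵇ t S) * 2 ^ card t) * 𝟙 (eqBs Q t))
    ≡⟨ ∑-δ k Q (λ t → 𝟙 h * (𝟙 (noConsec (true ∷ t) ∧ subᵇ t S) * 2 ^ card t)) ⟩
  𝟙 h * (𝟙 (noConsec (true ∷ Q) ∧ subᵇ Q S) * 2 ^ card Q)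
    ≡⟨ unconstrained h noConsec-hQ ⟩
  𝟙 h * (𝟙 (subᵇ Q S) * 2 ^ card Q)
    ∎
  where
  q : Subset (suc k) → Bool
  q F = noConsec (one ∪ F) ∧ subᵇ F (false ∷ S)
  W : Subset (suc k) → ℕ
  W F = 2 ^ card F * 𝟙 (eqBs (h ∷ Q) (one ∪ F))
  not-xor-true : ∀ h → not (h xor true) ≡ h
  not-xor-true false = refl
  not-xor-true true  = refl
  rearrange : ∀ h A B E → A * (B * 𝟙 (h ∧ E)) ≡ 𝟙 h * (A * B) * 𝟙 E
  rearrange false A B E = trans (cong (A *_) (*-zeroʳ B)) (*-zeroʳ A)
  rearrange true  A B E = trans (sym (*-assoc A B (𝟙 E))) (cong (_* 𝟙 E) (sym (*-identityˡ (A * B))))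
  summand : ∀ t → 𝟙 (q (false ∷ t)) * W (false ∷ t) + 𝟙 (q (true ∷ t)) * W (true ∷ t)
                ≡ 𝟙 h * (𝟙 (noConsec (true ∷ t) ∧ subᵇ t S) * 2 ^ card t) * 𝟙 (eqBs Q t)
  summand t = begin
    𝟙 (q (false ∷ t)) * W (false ∷ t) + 𝟙 (q (true ∷ t)) * W (true ∷ t)
      ≡⟨ cong (λ b → 𝟙 (q (false ∷ t)) * W (false ∷ t) + 𝟙 b * W (true ∷ t)) (∧-zeroʳ (noConsec (one ∪ (true ∷ t)))) ⟩
    𝟙 (q (false ∷ t)) * W (false ∷ t) + 0
      ≡⟨ +-identityʳ _ ⟩
    𝟙 (noConsec (true ∷ (⊥ ∪ t)) ∧ subᵇ t S) * (2 ^ card t * 𝟙 (not (h xor true) ∧ eqBs Q (⊥ ∪ t)))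
      ≡⟨ cong₂ (λ t′ g → 𝟙 (noConsec (true ∷ t′) ∧ subᵇ t S) * (2 ^ card t * 𝟙 (g ∧ eqBs Q t′))) (∪-identityˡ t) (not-xor-true h) ⟩
    𝟙 (noConsec (true ∷ t) ∧ subᵇ t S) * (2 ^ card t * 𝟙 (h ∧ eqBs Q t))
      ≡⟨ rearrange h (𝟙 (noConsec (true ∷ t) ∧ subᵇ t S)) (2 ^ card t) (eqBs Q t) ⟩
    𝟙 h * (𝟙 (noConsec (true ∷ t) ∧ subᵇ t S) * 2 ^ card t) * 𝟙 (eqBs Q t)
      ∎
  unconstrained : ∀ h → noConsec (h ∷ Q) ≡ true →
                  𝟙 h * (𝟙 (noConsec (true ∷ Q) ∧ subᵇ Q S) * 2 ^ card Q) ≡ 𝟙 h * (𝟙 (subᵇ Q S) * 2 ^ card Q)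
  unconstrained false _  = refl
  unconstrained true  nc = cong (λ b → 1 * (𝟙 (b ∧ subᵇ Q S) * 2 ^ card Q)) nc

sumB↭weighted : ∀ k S → sumB k (false ∷ S) ↭
  weighted (λ u → 𝟙 (Vec.head (peaks (0 ∷ u))) * (𝟙 (subᵇ (Vec.tail (peaks (0 ∷ u))) S) * 2 ^ card (Vec.tail (peaks (0 ∷ u)))))
           (Sn (suc (suc k)))
sumB↭weighted k S =
  ↭-trans (concatMap-weighted (λ F → (2 ^ card F) · P k (one ∪ F)) (λ F u → 2 ^ card F * 𝟙 (eqBs (Peak u) (one ∪ F))) Sn₂ Fs
                              (λ F → ↭-trans (·-↭ (2 ^ card F) (↭-reflexive (P≡weighted k (one ∪ F)))) (·-weighted (2 ^ card F) _ Sn₂)))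
          (↭-reflexive (weighted-cong (All.universal coefficient Sn₂)))
  where
  Sn₂ = Sn (suc (suc k))
  Fs = filterᵇ (λ F → noConsec (one ∪ F) ∧ subᵇ F (false ∷ S)) (allSubsets (suc k))
  coefficient : ∀ u → sum (map (λ F → 2 ^ card F * 𝟙 (eqBs (Peak u) (one ∪ F))) Fs)
                    ≡ 𝟙 (Vec.head (peaks (0 ∷ u))) * (𝟙 (subᵇ (Vec.tail (peaks (0 ∷ u))) S) * 2 ^ card (Vec.tail (peaks (0 ∷ u))))
  coefficient u rewrite Peak≡peaks u = sumB-coefficient k S (peaks (0 ∷ u)) (noConsec-peaks (0 ∷ u))

△-init : ∀ {m} b (J : Vec Bool m) → J △ Vec.init (b ∷ J) ≡ xorShifted b J
△-init b []      = refl
△-init b (a ∷ J) = cong ((a xor b) ∷_) (△-init a J)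

∪-init : ∀ {m} b (J : Vec Bool m) → J ∪ Vec.init (b ∷ J) ≡ orShifted b J
∪-init b []      = refl
∪-init b (a ∷ J) = cong ((a ∨ b) ∷_) (∪-init a J)

init-∪ : ∀ {m} (S T : Vec Bool (suc m)) → Vec.init (S ∪ T) ≡ Vec.init S ∪ Vec.init T
init-∪ {zero}  (a ∷ []) (b ∷ []) = refl
init-∪ {suc m} (a ∷ S)  (b ∷ T)  = cong ((a ∨ b) ∷_) (init-∪ S T)

△-shift : ∀ {k} (J : Vec Bool k) → (false ∷ J) △ shift (false ∷ J) ≡ xorShifted false (false ∷ J)
△-shift J = cong (false ∷_) (△-init false J)

△-two∪shift : ∀ {k} (J : Vec Bool k) → (false ∷ J) △ (two ∪ shift (false ∷ J)) ≡ xorShifted true (true ∷ J)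
△-two∪shift J = cong (false ∷_) (trans (cong (J △_) init-one∪) (△-init true J))
  where
  init-one∪ : Vec.init (true ∷ ⊥) ∪ Vec.init (false ∷ J) ≡ Vec.init (true ∷ J)
  init-one∪ = trans (sym (init-∪ (true ∷ ⊥) (false ∷ J))) (cong (λ T → Vec.init (true ∷ T)) (∪-identityˡ J))

∪-shift : ∀ {k} (J : Vec Bool k) → (false ∷ J) ∪ shift (false ∷ J) ≡ orShifted false (false ∷ J)
∪-shift J = cong (false ∷_) (∪-init false J)

∪-shift∪one : ∀ {k} (J : Vec Bool k) → (false ∷ J) ∪ shift (false ∷ J) ∪ one ≡ true ∷ orShifted false J
∪-shift∪one J = cong (true ∷_) (trans (cong (J ∪_) (∪-identityʳ _)) (∪-init false J))

∪-shift∪one∪two : ∀ {k} (J : Vec Bool k) → (false ∷ J) ∪ shift (false ∷ J) ∪ one ∪ two ≡ orShifted true (true ∷ J)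
∪-shift∪one∪two J = cong (true ∷_) (trans (cong (J ∪_) init-one∪) (∪-init true J))
  where
  init-one∪ : Vec.init (false ∷ J) ∪ (⊥ ∪ Vec.init (true ∷ ⊥)) ≡ Vec.init (true ∷ J)
  init-one∪ = trans (cong (Vec.init (false ∷ J) ∪_) (∪-identityˡ _))
                    (trans (sym (init-∪ (false ∷ J) (true ∷ ⊥))) (cong (λ T → Vec.init (true ∷ T)) (∪-identityʳ J)))

ψY-diag : ∀ k a (J : Vec Bool k) → ψ (Y k (a , a ∷ J)) ↭ sumA k (xorShifted a (a ∷ J))
ψY-diag k a J =
  ↭-trans (↭-reflexive (trans (ψY≡countD k a a J) (weighted-cong (All.map (λ {u} → countD-exact-diag a J u) (Sn-admissible _)))))
          (↭-sym (sumA↭weighted k (xorShifted a (a ∷ J))))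

ψY-offdiag : ∀ k b (J : Vec Bool k) → ψ (Y k (b , not b ∷ J)) ↭ sumB k (false ∷ xorShifted false J)
ψY-offdiag k b J =
  ↭-trans (↭-reflexive (trans (ψY≡countD k b (not b) J)
                              (weighted-cong (All.map (λ { {x ∷ y ∷ r} → countD-exact-offdiag b J x y r }) (Sn-admissible _)))))
          (↭-sym (sumB↭weighted k (xorShifted false J)))

ψX-diag : ∀ k a (J : Vec Bool k) → ψ (X k (a , a ∷ J)) ↭ 2 ^ card (a ∷ J) · sumC k (orShifted a (a ∷ J))
ψX-diag k a J =
  ↭-trans (ψX↭countD k a a J)
  (↭-trans (↭-reflexive (weighted-cong (All.map (λ {u} adm → trans (countD-within-diag a J u adm) (*-comm _ (2 ^ card (a ∷ J)))) (Sn-admissible _))))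
           (↭-sym (·sumC↭weighted k (2 ^ card (a ∷ J)) (orShifted a (a ∷ J)))))

ψX-offdiag : ∀ k b (J : Vec Bool k) → ψ (X k (b , not b ∷ J)) ↭ 2 ^ card J · sumC k (true ∷ orShifted false J)
ψX-offdiag k b J =
  ↭-trans (ψX↭countD k b (not b) J)
  (↭-trans (↭-reflexive (weighted-cong (All.map (λ { {x ∷ y ∷ r} adm → trans (countD-within-offdiag b J x y r adm) (coefficient x y r) })
                                                 (Sn-admissible _))))
           (↭-sym (·sumC↭weighted k (2 ^ card J) (true ∷ orShifted false J))))
  where
  coefficient : ∀ x y r → weightX x false (y ∷ r) J ≡ 2 ^ card J * 𝟙 (subᵇ (peaks (0 ∷ x ∷ y ∷ r)) (true ∷ orShifted false J))
  coefficient x y r rewrite ∨-zeroʳ (not (isPeak 0 x y)) = *-comm _ (2 ^ card J)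

proposition3p6 : (k : ℕ) (J : Subset (suc k)) → lookup J zero ≡ false →
    (ψ (Y k (false , J)) ↭ sumA k (J △ shift J))
    × (ψ (Y k (false , one ∪ J)) ↭ sumB k (J △ shift J))
    × (ψ (Y k (true , J)) ↭ sumB k (J △ shift J))
    × (ψ (Y k (true , one ∪ J)) ↭ sumA k (J △ (two ∪ shift J)))
    × (ψ (X k (false , J)) ↭ (2 ^ card J) · sumC k (J ∪ shift J))
    × (ψ (X k (false , one ∪ J)) ↭ (2 ^ card J) · sumC k (J ∪ shift J ∪ one))
    × (ψ (X k (true , J)) ↭ (2 ^ card J) · sumC k (J ∪ shift J ∪ one))
    × (ψ (X k (true , one ∪ J)) ↭ (2 ^ (card J + 1)) · sumC k (J ∪ shift J ∪ one ∪ two))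
-- one ∪ (false ∷ J) computes to true ∷ (⊥ ∪ J), hence ∪-identityˡ.
proposition3p6 k (false ∷ J) refl
  rewrite △-shift J | ∪-identityˡ J | △-two∪shift J | ∪-shift J | ∪-shift∪one J | ∪-shift∪one∪two J | +-comm (card J) 1 =
    ψY-diag k false J , ψY-offdiag k false J , ψY-offdiag k true J , ψY-diag k true J ,
    ψX-diag k false J , ψX-offdiag k false J , ψX-offdiag k true J , ψX-diag k true J
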